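{- Let $A=(a_{ij})_{1 \leq i,j \leq d} \in \{0,1,2\}^{d \times d}$ be an integer matrix such that each row $(a_{i1},\ldots,a_{id})$ satisfies $a_{id}=1$ and $|a_{i1}+\cdots+a_{i,d-1}| \leq 2$. If $\det(A)\neq 0$, then for some integer $0\le s\le d$, $A \sim D_s$, where $D_s$ is the $d\times d$ diagonal matrix whose first $s$ diagonal entries equal $1$ and whose remaining $d-s$ diagonal entries equal $2$. In this case, $2A^{ -1}\in\mathbb{Z}^{d\times d}$.
   Context: For $d\times d$ integer matrices $A,B$, write $A\sim B$ if $B$ can be obtained from $A$ by a sequence of elementary row and column operations over $\mathbb{Z}$ (i.e., interchanging two rows/columns, multiplying a row/column by $-1$, adding an integer multiple of one row/column to another). -}

module Defs where

open import Data.Nat using (ℕ; zero; suc)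
open import Data.Fin using (Fin; zero; suc; punchIn; _≟_)
open import Data.Integer using (ℤ; _+_; _*_; -_; +_; -1ℤ; 0ℤ; 1ℤ)
open import Relation.Nullary using (yes; no)
open import Relation.Binary.PropositionalEquality using (_≡_; _≢_)

Mat : ℕ → Set
Mat d = Fin d → Fin d → ℤ

Σ[_] : (n : ℕ) → (Fin n → ℤ) → ℤ
Σ[ zero ] f = 0ℤ
Σ[ suc n ] f = f zero + Σ[ n ] (λ i → f (suc i))

sgn : ℕ → ℤ
sgn zero = 1ℤ
sgn (suc k) = - sgn k

det : (d : ℕ) → Mat d → ℤ
det zero A = 1ℤ
det (suc n) A =
  Σ[ suc n ] (λ j → sgn (Data.Fin.toℕ j) * (A zero j *
     det n (λ r c → A (suc r) (punchIn j c))))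

_·_ : ∀ {d} → Mat d → Mat d → Mat d
_·_ {d} A B i j = Σ[ d ] (λ k → A i k * B k j)

δ : ∀ {d} → Fin d → Fin d → ℤ
δ i j with i ≟ j
... | yes _ = 1ℤ
... | no _ = 0ℤ

scale : ∀ {d} → ℤ → Mat d → Mat d
scale c A i j = c * A i j

I : ∀ {d} → Mat d
I = δ

swapRows : ∀ {d} → Fin d → Fin d → Mat d → Mat d
swapRows i j A r with r ≟ i | r ≟ j
... | yes _ | _ = A j
... | no _ | yes _ = A i
... | no _ | no _ = A r

negRow : ∀ {d} → Fin d → Mat d → Mat d
negRow i A r c with r ≟ i
... | yes _ = - A r c
... | no _ = A r c

addRow : ∀ {d} → Fin d → Fin d → ℤ → Mat d → Mat d
addRow i j c A r col with r ≟ i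
... | yes _ = A r col + c * A j col
... | no _ = A r col

transpose : ∀ {d} → Mat d → Mat d
transpose A i j = A j i

data ElemStep {d : ℕ} : Mat d → Mat d → Set where
  rowSwap : ∀ A i j → ElemStep A (swapRows i j A)
  rowNeg  : ∀ A i → ElemStep A (negRow i A)
  rowAdd  : ∀ A i j c → i ≢ j → ElemStep A (addRow i j c A)
  colSwap : ∀ A i j → ElemStep A (transpose (swapRows i j (transpose A)))
  colNeg  : ∀ A i → ElemStep A (transpose (negRow i (transpose A)))
  colAdd  : ∀ A i j c → i ≢ j → ElemStep A (transpose (addRow i j c (transpose A)))

-- A ∼ B : B is obtained from A by a finite sequence of elementary operations
-- (matrices compared pointwise, since they are functions)
data _∼_ {d : ℕ} : Mat d → Mat d → Set where
  done : ∀ {A B} → (∀ i j → A i j ≡ B i j) → A ∼ B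
  step : ∀ {A B C} → ElemStep A B → B ∼ C → A ∼ C

D : ∀ {d} → ℕ → Mat d
D s i j with i ≟ j
... | no _ = 0ℤ
... | yes _ with Data.Nat._<?_ (Data.Fin.toℕ i) s
...   | yes _ = 1ℤ
...   | no _ = + 2

data In012 : ℤ → Set where
  is0 : In012 (+ 0)
  is1 : In012 (+ 1)
  is2 : In012 (+ 2)

module Submission where

-- Write ψ(a, t) = (2t − Σ a, a).  The hypotheses say that every "incidence row" ψ(A i)
-- has weight (ℓ¹-norm) at most 2, and det A ≠ 0 gives A a trivial kernel (Cramer's rule).  We prove
-- by induction on the size that such ψ-bounded matrices are ∼ D_s: pick one of the first columns
-- of weight ≤ 2 and split off a 1×1 block by elementary operations (a single ±1 is split off; two
-- ±1 are first reduced to one by a row operation; a single ±2 is a "loop" row, whose removal leaves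
-- a matrix with rows of weight ≤ 2, handled by the analogous and simpler theorem for small rows).
-- If no such column exists, counting weights forces a kernel vector (1, …, 1, −2) or the 2×2 case.
-- Finally every chain of elementary operations is B = P A Q with P, Q unimodular, which transports
-- both the trivial kernel and the existence of an inverse up to the factor 2 (true for D_s).

open import Defs
open import Data.Nat using (ℕ; suc; _≤_)
open import Data.Fin using (Fin; fromℕ; inject₁)
open import Data.Integer using (ℤ; +_; ∣_∣; 0ℤ)
open import Data.Product using (Σ; _×_)
open import Relation.Binary.PropositionalEquality using (_≡_; _≢_)

open import Data.Nat using (zero; _<_; _<?_; _≤?_; z≤n; s≤s) renaming (_+_ to _+ℕ_; _*_ to _*ℕ_)
import Data.Nat.Properties as ℕP
import Data.Nat.Tactic.RingSolver as ℕSolver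
open import Data.Fin using (zero; suc; _≟_; punchIn; punchOut; toℕ; fromℕ<)
import Data.Fin.Properties as FinP
open import Data.Integer using (_+_; _*_; -_; -[1+_]; 1ℤ; -1ℤ)
import Data.Integer.Properties as ℤP
open import Algebra.Properties.AbelianGroup ℤP.+-0-abelianGroup using (∙-cancelʳ)
open import Data.Integer.Tactic.RingSolver using (solve-∀)
open import Data.Empty using (⊥; ⊥-elim)
open import Data.Sum using (_⊎_; inj₁; inj₂)
open import Data.Product using (_,_; proj₁; proj₂)
open import Function using (_∘_)
open import Relation.Nullary using (Dec; yes; no; ¬_)
open import Relation.Binary.PropositionalEquality using (refl; sym; trans; cong; cong₂; subst; subst₂)
open import Relation.Binary.Bundles using (Setoid)
import Relation.Binary.Reasoning.Setoid as SetoidReasoning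
open import Relation.Binary.Definitions using (tri<; tri≈; tri>)
open import Data.Fin.Relation.Unary.Top using (view; ‵fromℕ; ‵inject₁)

Σ-cong : ∀ n {f g : Fin n → ℤ} → (∀ i → f i ≡ g i) → Σ[ n ] f ≡ Σ[ n ] g
Σ-cong zero e = refl
Σ-cong (suc n) e = cong₂ _+_ (e zero) (Σ-cong n (λ i → e (suc i)))

Σ-+ : ∀ n (f g : Fin n → ℤ) → Σ[ n ] (λ i → f i + g i) ≡ Σ[ n ] f + Σ[ n ] g
Σ-+ zero f g = refl
Σ-+ (suc n) f g rewrite Σ-+ n (λ i → f (suc i)) (λ i → g (suc i)) =
  interchange (f zero) (g zero) (Σ[ n ] (λ i → f (suc i))) (Σ[ n ] (λ i → g (suc i)))
  where
  interchange : ∀ a b x y → (a + b) + (x + y) ≡ (a + x) + (b + y)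
  interchange = solve-∀

Σ-*ˡ : ∀ n c (f : Fin n → ℤ) → Σ[ n ] (λ i → c * f i) ≡ c * Σ[ n ] f
Σ-*ˡ zero c f = sym (ℤP.*-zeroʳ c)
Σ-*ˡ (suc n) c f rewrite Σ-*ˡ n c (λ i → f (suc i)) = sym (ℤP.*-distribˡ-+ c (f zero) _)

Σ-*ʳ : ∀ n c (f : Fin n → ℤ) → Σ[ n ] (λ i → f i * c) ≡ Σ[ n ] f * c
Σ-*ʳ n c f = trans (Σ-cong n (λ i → ℤP.*-comm (f i) c)) (trans (Σ-*ˡ n c f) (ℤP.*-comm c _))

Σ-neg : ∀ n (f : Fin n → ℤ) → Σ[ n ] (λ i → - f i) ≡ - Σ[ n ] f
Σ-neg n f = trans (Σ-cong n (λ i → neg-as-* (f i))) (trans (Σ-*ˡ n -1ℤ f) (sym (neg-as-* _)))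
  where
  neg-as-* : ∀ x → - x ≡ -1ℤ * x
  neg-as-* = solve-∀

Σ-zero : ∀ n (f : Fin n → ℤ) → (∀ i → f i ≡ 0ℤ) → Σ[ n ] f ≡ 0ℤ
Σ-zero zero f z = refl
Σ-zero (suc n) f z = cong₂ _+_ (z zero) (Σ-zero n _ (λ i → z (suc i)))

Σ-punch : ∀ n (f : Fin (suc n) → ℤ) k → Σ[ suc n ] f ≡ f k + Σ[ n ] (λ i → f (punchIn k i))
Σ-punch n f zero = refl
Σ-punch (suc n) f (suc k) rewrite Σ-punch n (λ i → f (suc i)) k =
  exchange (f zero) (f (suc k)) (Σ[ n ] (λ i → f (suc (punchIn k i))))
  where
  exchange : ∀ a b x → a + (b + x) ≡ b + (a + x)
  exchange = solve-∀

Σ-last : ∀ n (f : Fin (suc n) → ℤ) → Σ[ suc n ] f ≡ Σ[ n ] (λ j → f (inject₁ j)) + f (fromℕ n)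
Σ-last zero f = ℤP.+-comm (f zero) 0ℤ
Σ-last (suc n) f = trans (cong (_+_ (f zero)) (Σ-last n (λ i → f (suc i))))
                         (sym (ℤP.+-assoc (f zero) _ (f (fromℕ (suc n)))))

Σ-single : ∀ n (f : Fin n → ℤ) k → (∀ i → i ≢ k → f i ≡ 0ℤ) → Σ[ n ] f ≡ f k
Σ-single (suc n) f k z =
  trans (Σ-punch n f k)
        (trans (cong (_+_ (f k)) (Σ-zero n _ (λ i → z _ (FinP.punchInᵢ≢i k i)))) (ℤP.+-identityʳ _))

-- Changing one summand changes the sum by the same amount (stated without subtraction).
Σ-update : ∀ n (f g : Fin n → ℤ) k → (∀ i → i ≢ k → f i ≡ g i) → Σ[ n ] g + f k ≡ Σ[ n ] f + g k
Σ-update (suc n) f g k e rewrite Σ-punch n f k | Σ-punch n g k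
  | Σ-cong n (λ i → sym (e (punchIn k i) (FinP.punchInᵢ≢i k i))) =
  exchange (g k) (f k) (Σ[ n ] (λ i → f (punchIn k i)))
  where
  exchange : ∀ a b x → a + x + b ≡ b + x + a
  exchange = solve-∀

Σ-swap : ∀ m n (f : Fin m → Fin n → ℤ) →
  Σ[ m ] (λ i → Σ[ n ] (f i)) ≡ Σ[ n ] (λ j → Σ[ m ] (λ i → f i j))
Σ-swap zero n f = sym (Σ-zero n _ (λ _ → refl))
Σ-swap (suc m) n f rewrite Σ-swap m n (λ i → f (suc i)) =
  sym (Σ-+ n (f zero) (λ j → Σ[ m ] (λ i → f (suc i) j)))

-- The transposition of i and j on Fin n; tr i j r is the r-th row of swapRows i j.
tr : ∀ {n} → Fin n → Fin n → Fin n → Fin n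
tr i j r with r ≟ i | r ≟ j
... | yes _ | _ = j
... | no _ | yes _ = i
... | no _ | no _ = r

tr-i : ∀ {n} (i j : Fin n) → tr i j i ≡ j
tr-i i j with i ≟ i
... | yes _ = refl
... | no i≢i = ⊥-elim (i≢i refl)

tr-j : ∀ {n} (i j : Fin n) → tr i j j ≡ i
tr-j i j with j ≟ i | j ≟ j
... | yes j≡i | _ = j≡i
... | no _ | yes _ = refl
... | no _ | no j≢j = ⊥-elim (j≢j refl)

tr-other : ∀ {n} (i j r : Fin n) → r ≢ i → r ≢ j → tr i j r ≡ r
tr-other i j r r≢i r≢j with r ≟ i | r ≟ j
... | yes r≡i | _ = ⊥-elim (r≢i r≡i)
... | no _ | yes r≡j = ⊥-elim (r≢j r≡j)
... | no _ | no _ = refl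

tr-involutive : ∀ {n} (i j r : Fin n) → tr i j (tr i j r) ≡ r
tr-involutive i j r = by-cases (r ≟ i) (r ≟ j)
  where
  by-cases : Dec (r ≡ i) → Dec (r ≡ j) → tr i j (tr i j r) ≡ r
  by-cases (yes refl) _ = trans (cong (tr r j) (tr-i r j)) (tr-j r j)
  by-cases (no _) (yes refl) = trans (cong (tr i r) (tr-j i r)) (tr-i i r)
  by-cases (no r≢i) (no r≢j) = trans (cong (tr i j) (tr-other i j r r≢i r≢j)) (tr-other i j r r≢i r≢j)

tr-injective : ∀ {n} (i j : Fin n) {r s} → tr i j r ≡ tr i j s → r ≡ s
tr-injective i j {r} {s} e =
  trans (sym (tr-involutive i j r)) (trans (cong (tr i j) e) (tr-involutive i j s))

tr-suc : ∀ {n} (i j r : Fin n) → tr (suc i) (suc j) (suc r) ≡ suc (tr i j r)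
tr-suc i j r = by-cases (r ≟ i) (r ≟ j)
  where
  by-cases : Dec (r ≡ i) → Dec (r ≡ j) → tr (suc i) (suc j) (suc r) ≡ suc (tr i j r)
  by-cases (yes refl) _ = trans (tr-i (suc r) (suc j)) (cong suc (sym (tr-i r j)))
  by-cases (no _) (yes refl) = trans (tr-j (suc i) (suc r)) (cong suc (sym (tr-j i r)))
  by-cases (no r≢i) (no r≢j) =
    trans (tr-other (suc i) (suc j) (suc r) (r≢i ∘ FinP.suc-injective) (r≢j ∘ FinP.suc-injective))
          (cong suc (sym (tr-other i j r r≢i r≢j)))

tr-inject₁ : ∀ {n} (i j r : Fin n) → tr (inject₁ i) (inject₁ j) (inject₁ r) ≡ inject₁ (tr i j r)
tr-inject₁ i j r = by-cases (r ≟ i) (r ≟ j)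
  where
  by-cases : Dec (r ≡ i) → Dec (r ≡ j) → tr (inject₁ i) (inject₁ j) (inject₁ r) ≡ inject₁ (tr i j r)
  by-cases (yes refl) _ = trans (tr-i (inject₁ r) (inject₁ j)) (cong inject₁ (sym (tr-i r j)))
  by-cases (no _) (yes refl) = trans (tr-j (inject₁ i) (inject₁ r)) (cong inject₁ (sym (tr-j i r)))
  by-cases (no r≢i) (no r≢j) =
    trans (tr-other (inject₁ i) (inject₁ j) (inject₁ r) (r≢i ∘ FinP.inject₁-injective) (r≢j ∘ FinP.inject₁-injective))
          (cong inject₁ (sym (tr-other i j r r≢i r≢j)))

tr-fromℕ : ∀ {n} (i j : Fin n) → tr (inject₁ i) (inject₁ j) (fromℕ n) ≡ fromℕ n
tr-fromℕ i j = tr-other (inject₁ i) (inject₁ j) (fromℕ _) FinP.fromℕ≢inject₁ FinP.fromℕ≢inject₁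

Σ-tr : ∀ n (f : Fin n → ℤ) i j → Σ[ n ] (λ r → f (tr i j r)) ≡ Σ[ n ] f
Σ-tr n f i j with i ≟ j
... | yes refl = Σ-cong n (λ r → cong f (tr-same r))
  where
  tr-same : ∀ r → tr i i r ≡ r
  tr-same r with r ≟ i
  ... | yes r≡i = sym r≡i
  ... | no _ = refl
... | no i≢j = ∙-cancelʳ (f j) _ _ (trans second first)
  where
  -- h is f with its i-th value replaced by f j: halfway between f and f ∘ tr i j.
  h : Fin n → ℤ
  h r with r ≟ i
  ... | yes _ = f j
  ... | no _ = f r
  h-i : h i ≡ f j
  h-i with i ≟ i
  ... | yes _ = refl
  ... | no i≢i = ⊥-elim (i≢i refl)
  h-j : h j ≡ f j
  h-j with j ≟ i
  ... | yes j≡i = ⊥-elim (i≢j (sym j≡i))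
  ... | no _ = refl
  f≡h : ∀ r → r ≢ i → f r ≡ h r
  f≡h r r≢i with r ≟ i
  ... | yes r≡i = ⊥-elim (r≢i r≡i)
  ... | no _ = refl
  h≡f∘tr : ∀ r → r ≢ j → h r ≡ f (tr i j r)
  h≡f∘tr r r≢j = by-cases (r ≟ i)
    where
    by-cases : Dec (r ≡ i) → h r ≡ f (tr i j r)
    by-cases (yes refl) = trans h-i (cong f (sym (tr-i i j)))
    by-cases (no r≢i) = trans (sym (f≡h r r≢i)) (cong f (sym (tr-other i j r r≢i r≢j)))
  first : Σ[ n ] h + f i ≡ Σ[ n ] f + f j
  first = trans (Σ-update n f h i f≡h) (cong (_+_ (Σ[ n ] f)) h-i)
  second : Σ[ n ] (λ r → f (tr i j r)) + f j ≡ Σ[ n ] h + f i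
  second = trans (cong (_+_ (Σ[ n ] (λ r → f (tr i j r)))) (sym h-j))
                 (trans (Σ-update n h (λ r → f (tr i j r)) j h≡f∘tr) (cong (_+_ (Σ[ n ] h)) (cong f (tr-j i j))))

ΣN : ∀ n → (Fin n → ℕ) → ℕ
ΣN zero f = 0
ΣN (suc n) f = f zero +ℕ ΣN n (λ i → f (suc i))

ΣN-as-Σ : ∀ n (f : Fin n → ℕ) → + ΣN n f ≡ Σ[ n ] (λ i → + f i)
ΣN-as-Σ zero f = refl
ΣN-as-Σ (suc n) f = cong (_+_ (+ f zero)) (ΣN-as-Σ n (λ i → f (suc i)))

ΣN-from-Σ : ∀ n m (f : Fin n → ℕ) (g : Fin m → ℕ) →
  Σ[ n ] (λ i → + f i) ≡ Σ[ m ] (λ i → + g i) → ΣN n f ≡ ΣN m g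
ΣN-from-Σ n m f g e = ℤP.+-injective (trans (ΣN-as-Σ n f) (trans e (sym (ΣN-as-Σ m g))))

ΣN-cong : ∀ n {f g : Fin n → ℕ} → (∀ i → f i ≡ g i) → ΣN n f ≡ ΣN n g
ΣN-cong zero e = refl
ΣN-cong (suc n) e = cong₂ _+ℕ_ (e zero) (ΣN-cong n (λ i → e (suc i)))

ΣN-mono : ∀ n {f g : Fin n → ℕ} → (∀ i → f i ≤ g i) → ΣN n f ≤ ΣN n g
ΣN-mono zero e = z≤n
ΣN-mono (suc n) e = ℕP.+-mono-≤ (e zero) (ΣN-mono n (λ i → e (suc i)))

ΣN-const : ∀ n c → ΣN n (λ _ → c) ≡ n *ℕ c
ΣN-const zero c = refl
ΣN-const (suc n) c = cong (c +ℕ_) (ΣN-const n c)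

ΣN-+ : ∀ n (f g : Fin n → ℕ) → ΣN n (λ i → f i +ℕ g i) ≡ ΣN n f +ℕ ΣN n g
ΣN-+ zero f g = refl
ΣN-+ (suc n) f g rewrite ΣN-+ n (λ i → f (suc i)) (λ i → g (suc i)) =
  interchange (f zero) (g zero) _ _
  where
  interchange : ∀ a b x y → a +ℕ b +ℕ (x +ℕ y) ≡ a +ℕ x +ℕ (b +ℕ y)
  interchange = ℕSolver.solve-∀

ΣN-punch : ∀ n (f : Fin (suc n) → ℕ) k → ΣN (suc n) f ≡ f k +ℕ ΣN n (λ i → f (punchIn k i))
ΣN-punch n f k = ℤP.+-injective
  (trans (ΣN-as-Σ (suc n) f) (trans (Σ-punch n (λ i → + f i) k)
         (sym (cong (_+_ (+ f k)) (ΣN-as-Σ n (λ i → f (punchIn k i)))))))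

ΣN-last : ∀ n (f : Fin (suc n) → ℕ) → ΣN (suc n) f ≡ ΣN n (λ j → f (inject₁ j)) +ℕ f (fromℕ n)
ΣN-last n f = ℤP.+-injective
  (trans (ΣN-as-Σ (suc n) f) (trans (Σ-last n (λ i → + f i))
         (sym (cong (_+ + f (fromℕ n)) (ΣN-as-Σ n (λ j → f (inject₁ j)))))))

ΣN-swap : ∀ m n (f : Fin m → Fin n → ℕ) → ΣN m (λ i → ΣN n (f i)) ≡ ΣN n (λ j → ΣN m (λ i → f i j))
ΣN-swap m n f = ΣN-from-Σ m n _ _
  (trans (Σ-cong m (λ i → ΣN-as-Σ n (f i)))
  (trans (Σ-swap m n (λ i j → + f i j)) (sym (Σ-cong n (λ j → ΣN-as-Σ m (λ i → f i j))))))

ΣN-zero : ∀ n (f : Fin n → ℕ) → ΣN n f ≡ 0 → ∀ i → f i ≡ 0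
ΣN-zero (suc n) f e zero = ℕP.m+n≡0⇒m≡0 (f zero) e
ΣN-zero (suc n) f e (suc i) = ΣN-zero n (λ i → f (suc i)) (ℕP.m+n≡0⇒n≡0 (f zero) e) i

ΣN-term : ∀ n (f : Fin n → ℕ) k → f k ≤ ΣN n f
ΣN-term (suc n) f k = subst (f k ≤_) (sym (ΣN-punch n f k)) (ℕP.m≤m+n (f k) _)

ΣN-two-terms : ∀ n (f : Fin n → ℕ) k l → k ≢ l → f k +ℕ f l ≤ ΣN n f
ΣN-two-terms (suc n) f k l k≢l = subst (f k +ℕ f l ≤_) (sym (ΣN-punch n f k))
  (ℕP.+-monoʳ-≤ (f k) (subst (λ z → f z ≤ _) (FinP.punchIn-punchOut k≢l)
                             (ΣN-term n (λ i → f (punchIn k i)) (punchOut k≢l))))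

Wt : ∀ {n} → (Fin n → ℤ) → ℕ
Wt {n} v = ΣN n (λ i → ∣ v i ∣)

Wt-cong : ∀ {n} {v w : Fin n → ℤ} → (∀ i → v i ≡ w i) → Wt v ≡ Wt w
Wt-cong {n} e = ΣN-cong n (λ i → cong ∣_∣ (e i))

Wt-tr : ∀ {n} (v : Fin n → ℤ) i j → Wt (λ c → v (tr i j c)) ≡ Wt v
Wt-tr {n} v i j = ΣN-from-Σ n n _ _ (Σ-tr n (λ c → + ∣ v c ∣) i j)

Wt-punch : ∀ {n} (v : Fin (suc n) → ℤ) b → Wt v ≡ ∣ v b ∣ +ℕ Wt (λ i → v (punchIn b i))
Wt-punch {n} v b = ΣN-punch n (λ c → ∣ v c ∣) b

Wt-last : ∀ {n} (v : Fin (suc n) → ℤ) → Wt v ≡ Wt (λ j → v (inject₁ j)) +ℕ ∣ v (fromℕ n) ∣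
Wt-last {n} v = ΣN-last n (λ c → ∣ v c ∣)

Wt-zero : ∀ {n} (v : Fin n → ℤ) → Wt v ≡ 0 → ∀ i → v i ≡ 0ℤ
Wt-zero {n} v e i = ℤP.∣i∣≡0⇒i≡0 (ΣN-zero n (λ c → ∣ v c ∣) e i)

abs≡1 : ∀ x → ∣ x ∣ ≡ 1 → x ≡ 1ℤ ⊎ x ≡ -1ℤ
abs≡1 (+ .1) refl = inj₁ refl
abs≡1 (-[1+ zero ]) refl = inj₂ refl

unit-square : ∀ x → ∣ x ∣ ≡ 1 → x * x ≡ 1ℤ
unit-square x e with abs≡1 x e
... | inj₁ refl = refl
... | inj₂ refl = refl

concentrated : ∀ {n} (v : Fin n → ℤ) j → ∣ v j ∣ ≡ 2 → Wt v ≤ 2 → ∀ k → k ≢ j → v k ≡ 0ℤ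
concentrated {suc n} v j e le k k≢j =
  subst (λ z → v z ≡ 0ℤ) (FinP.punchIn-punchOut j≢k) (Wt-zero (λ i → v (punchIn j i)) rest≡0 (punchOut j≢k))
  where
  j≢k = λ p → k≢j (sym p)
  rest = Wt (λ i → v (punchIn j i))
  rest≡0 : rest ≡ 0
  rest≡0 = ℕP.n≤0⇒n≡0 (ℕP.+-cancelˡ-≤ 2 rest 0 (subst (_≤ 2) (trans (Wt-punch v j) (cong (_+ℕ rest) e)) le))

data Shape {m} (v : Fin m → ℤ) : Set where
  null : (∀ i → v i ≡ 0ℤ) → Shape v
  one-unit : ∀ r → ∣ v r ∣ ≡ 1 → (∀ i → i ≢ r → v i ≡ 0ℤ) → Shape v
  one-double : ∀ r → ∣ v r ∣ ≡ 2 → (∀ i → i ≢ r → v i ≡ 0ℤ) → Shape v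
  two-units : ∀ r₁ r₂ → r₁ ≢ r₂ → ∣ v r₁ ∣ ≡ 1 → ∣ v r₂ ∣ ≡ 1 →
              (∀ i → i ≢ r₁ → i ≢ r₂ → v i ≡ 0ℤ) → Shape v

overweight : ∀ {m} (v : Fin (suc m) → ℤ) a b → Wt v ≤ 2 → a ≤ ∣ v zero ∣ → b ≤ Wt (λ i → v (suc i)) →
  2 < a +ℕ b → ⊥
overweight v a b le a≤ b≤ 2<a+b = ℕP.<-irrefl refl (ℕP.<-≤-trans 2<a+b (ℕP.≤-trans (ℕP.+-mono-≤ a≤ b≤) le))

shape : ∀ m (v : Fin m → ℤ) → Wt v ≤ 2 → Shape v
shape zero v le = null (λ ())
shape (suc m) v le
  with shape m (λ i → v (suc i)) (ℕP.m+n≤o⇒n≤o ∣ v zero ∣ le) | ∣ v zero ∣ in head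
... | null z | zero = null λ { zero → ℤP.∣i∣≡0⇒i≡0 head ; (suc i) → z i }
... | null z | 1 = one-unit zero head λ { zero 0≢0 → ⊥-elim (0≢0 refl) ; (suc i) _ → z i }
... | null z | 2 = one-double zero head λ { zero 0≢0 → ⊥-elim (0≢0 refl) ; (suc i) _ → z i }
... | null z | suc (suc (suc k)) = ⊥-elim (overweight v 3 0 le (head≥ 3 (s≤s (s≤s (s≤s z≤n)))) z≤n ℕP.≤-refl)
  where
  head≥ : ∀ a → a ≤ suc (suc (suc k)) → a ≤ ∣ v zero ∣
  head≥ a p = subst (a ≤_) (sym head) p
... | one-unit r e z | zero = one-unit (suc r) e λ { zero _ → ℤP.∣i∣≡0⇒i≡0 head ; (suc i) i≢r → z i (i≢r ∘ cong suc) }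
... | one-unit r e z | 1 = two-units zero (suc r) (λ ()) head e
      λ { zero 0≢0 _ → ⊥-elim (0≢0 refl) ; (suc i) _ i≢r → z i (i≢r ∘ cong suc) }
... | one-unit r e z | suc (suc k) =
  ⊥-elim (overweight v 2 1 le (subst (2 ≤_) (sym head) (s≤s (s≤s z≤n)))
                     (subst (_≤ _) e (ΣN-term m (λ i → ∣ v (suc i) ∣) r)) ℕP.≤-refl)
... | one-double r e z | zero = one-double (suc r) e λ { zero _ → ℤP.∣i∣≡0⇒i≡0 head ; (suc i) i≢r → z i (i≢r ∘ cong suc) }
... | one-double r e z | suc k =
  ⊥-elim (overweight v 1 2 le (subst (1 ≤_) (sym head) (s≤s z≤n))
                     (subst (_≤ _) e (ΣN-term m (λ i → ∣ v (suc i) ∣) r)) ℕP.≤-refl)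
... | two-units r₁ r₂ r₁≢r₂ e₁ e₂ z | zero = two-units (suc r₁) (suc r₂) (r₁≢r₂ ∘ FinP.suc-injective) e₁ e₂
      λ { zero _ _ → ℤP.∣i∣≡0⇒i≡0 head ; (suc i) a b → z i (a ∘ cong suc) (b ∘ cong suc) }
... | two-units r₁ r₂ r₁≢r₂ e₁ e₂ z | suc k =
  ⊥-elim (overweight v 1 2 le (subst (1 ≤_) (sym head) (s≤s z≤n))
                     (subst (_≤ Wt (λ i → v (suc i))) (cong₂ _+ℕ_ e₁ e₂) (ΣN-two-terms m (λ i → ∣ v (suc i) ∣) r₁ r₂ r₁≢r₂)) ℕP.≤-refl)

infix 4 _≈_
_≈_ : ∀ {d} → Mat d → Mat d → Set
A ≈ B = ∀ i j → A i j ≡ B i j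

≈-refl : ∀ {d} {A : Mat d} → A ≈ A
≈-refl i j = refl

≈-sym : ∀ {d} {A B : Mat d} → A ≈ B → B ≈ A
≈-sym e i j = sym (e i j)

≈-trans : ∀ {d} {A B C : Mat d} → A ≈ B → B ≈ C → A ≈ C
≈-trans e f i j = trans (e i j) (f i j)

Mat-setoid : ℕ → Setoid _ _
Mat-setoid d = record
  { Carrier = Mat d ; _≈_ = _≈_
  ; isEquivalence = record { refl = ≈-refl ; sym = ≈-sym ; trans = ≈-trans } }

module ≈-Reasoning {d} = SetoidReasoning (Mat-setoid d)

O : ∀ {d} → Mat d
O _ _ = 0ℤ

δ-same : ∀ {d} (i : Fin d) → δ i i ≡ 1ℤ
δ-same i with i ≟ i
... | yes _ = refl
... | no i≢i = ⊥-elim (i≢i refl)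

δ-other : ∀ {d} (i j : Fin d) → i ≢ j → δ i j ≡ 0ℤ
δ-other i j i≢j with i ≟ j
... | yes i≡j = ⊥-elim (i≢j i≡j)
... | no _ = refl

δ-sym : ∀ {d} (i j : Fin d) → δ i j ≡ δ j i
δ-sym i j with i ≟ j | j ≟ i
... | yes _ | yes _ = refl
... | no _ | no _ = refl
... | yes i≡j | no j≢i = ⊥-elim (j≢i (sym i≡j))
... | no i≢j | yes j≡i = ⊥-elim (i≢j (sym j≡i))

·-congˡ : ∀ {d} {A A' : Mat d} (B : Mat d) → A ≈ A' → A · B ≈ A' · B
·-congˡ {d} B eA i j = Σ-cong d (λ k → cong (_* B k j) (eA i k))

·-congʳ : ∀ {d} (A : Mat d) {B B' : Mat d} → B ≈ B' → A · B ≈ A · B'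
·-congʳ {d} A eB i j = Σ-cong d (λ k → cong (A i k *_) (eB k j))

·-assoc : ∀ {d} (A B C : Mat d) → (A · B) · C ≈ A · (B · C)
·-assoc {d} A B C i j =
  trans (Σ-cong d (λ k → sym (Σ-*ʳ d (C k j) (λ l → A i l * B l k))))
  (trans (Σ-swap d d (λ k l → A i l * B l k * C k j))
  (Σ-cong d (λ l → trans (Σ-cong d (λ k → ℤP.*-assoc (A i l) (B l k) (C k j))) (Σ-*ˡ d (A i l) (λ k → B l k * C k j)))))

·-identityˡ : ∀ {d} (A : Mat d) → I · A ≈ A
·-identityˡ {d} A i j =
  trans (Σ-single d _ i (λ k k≢i → trans (cong (_* A k j) (δ-other i k (k≢i ∘ sym))) (ℤP.*-zeroˡ (A k j))))
        (trans (cong (_* A i j) (δ-same i)) (ℤP.*-identityˡ _))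

·-identityʳ : ∀ {d} (A : Mat d) → A · I ≈ A
·-identityʳ {d} A i j =
  trans (Σ-single d _ j (λ k k≢j → trans (cong (A i k *_) (δ-other k j k≢j)) (ℤP.*-zeroʳ (A i k))))
        (trans (cong (A i j *_) (δ-same j)) (ℤP.*-identityʳ _))

·-zeroʳ : ∀ {d} (A : Mat d) → A · O ≈ O
·-zeroʳ {d} A i j = Σ-zero d _ (λ k → ℤP.*-zeroʳ (A i k))

scale-cong : ∀ {d} c {A B : Mat d} → A ≈ B → scale c A ≈ scale c B
scale-cong c e i j = cong (c *_) (e i j)

·-scaleˡ : ∀ {d} c (A B : Mat d) → scale c A · B ≈ scale c (A · B)
·-scaleˡ {d} c A B i j = trans (Σ-cong d (λ k → ℤP.*-assoc c (A i k) (B k j))) (Σ-*ˡ d c (λ k → A i k * B k j))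

·-scaleʳ : ∀ {d} c (A B : Mat d) → A · scale c B ≈ scale c (A · B)
·-scaleʳ {d} c A B i j = trans (Σ-cong d (λ k → commute c (A i k) (B k j))) (Σ-*ˡ d c (λ k → A i k * B k j))
  where
  commute : ∀ c a b → a * (c * b) ≡ c * (a * b)
  commute = solve-∀

transpose-· : ∀ {d} (A B : Mat d) → transpose (A · B) ≈ transpose B · transpose A
transpose-· {d} A B i j = Σ-cong d (λ k → ℤP.*-comm (A j k) (B k i))

Invertible : ∀ {d} → Mat d → Set
Invertible {d} U = Σ (Mat d) λ V → U · V ≈ I × V · U ≈ I

I-invertible : ∀ {d} → Invertible {d} I
I-invertible = I , ·-identityˡ I , ·-identityˡ I

·-invertible : ∀ {d} {U V : Mat d} → Invertible U → Invertible V → Invertible (U · V)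
·-invertible {d} {U} {V} (U' , UU' , U'U) (V' , VV' , V'V) = V' · U' , right , left
  where
  open ≈-Reasoning
  right : (U · V) · (V' · U') ≈ I
  right = begin
    (U · V) · (V' · U') ≈⟨ ·-assoc U V (V' · U') ⟩
    U · (V · (V' · U')) ≈⟨ ·-congʳ U (≈-sym (·-assoc V V' U')) ⟩
    U · ((V · V') · U') ≈⟨ ·-congʳ U (·-congˡ U' VV') ⟩
    U · (I · U')        ≈⟨ ·-congʳ U (·-identityˡ U') ⟩
    U · U'              ≈⟨ UU' ⟩
    I                   ∎
  left : (V' · U') · (U · V) ≈ I
  left = begin
    (V' · U') · (U · V) ≈⟨ ·-assoc V' U' (U · V) ⟩
    V' · (U' · (U · V)) ≈⟨ ·-congʳ V' (≈-sym (·-assoc U' U V)) ⟩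
    V' · ((U' · U) · V) ≈⟨ ·-congʳ V' (·-congˡ V U'U) ⟩
    V' · (I · V)        ≈⟨ ·-congʳ V' (·-identityˡ V) ⟩
    V' · V              ≈⟨ V'V ⟩
    I                   ∎

transpose-invertible : ∀ {d} {U : Mat d} → Invertible U → Invertible (transpose U)
transpose-invertible {d} {U} (V , UV , VU) = transpose V , flip V U VU , flip U V UV
  where
  flip : ∀ (X Y : Mat d) → X · Y ≈ I → transpose Y · transpose X ≈ I
  flip X Y XY i j = trans (sym (transpose-· X Y i j)) (trans (XY j i) (δ-sym j i))

swap-entry : ∀ {d} (i j : Fin d) (A : Mat d) r c → swapRows i j A r c ≡ A (tr i j r) c
swap-entry i j A r c with r ≟ i | r ≟ j
... | yes _ | _ = refl
... | no _ | yes _ = refl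
... | no _ | no _ = refl

neg-same : ∀ {d} (i : Fin d) (A : Mat d) c → negRow i A i c ≡ - A i c
neg-same i A c with i ≟ i
... | yes _ = refl
... | no i≢i = ⊥-elim (i≢i refl)

neg-other : ∀ {d} (i : Fin d) (A : Mat d) r c → r ≢ i → negRow i A r c ≡ A r c
neg-other i A r c r≢i with r ≟ i
... | yes r≡i = ⊥-elim (r≢i r≡i)
... | no _ = refl

add-same : ∀ {d} (i j : Fin d) x (A : Mat d) c → addRow i j x A i c ≡ A i c + x * A j c
add-same i j x A c with i ≟ i
... | yes _ = refl
... | no i≢i = ⊥-elim (i≢i refl)

add-other : ∀ {d} (i j : Fin d) x (A : Mat d) r c → r ≢ i → addRow i j x A r c ≡ A r c
add-other i j x A r c r≢i with r ≟ i
... | yes r≡i = ⊥-elim (r≢i r≡i)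
... | no _ = refl

swap-cong : ∀ {d} (i j : Fin d) {A B : Mat d} → A ≈ B → swapRows i j A ≈ swapRows i j B
swap-cong i j {A} {B} e r c = trans (swap-entry i j A r c) (trans (e _ c) (sym (swap-entry i j B r c)))

neg-cong : ∀ {d} (i : Fin d) {A B : Mat d} → A ≈ B → negRow i A ≈ negRow i B
neg-cong i e r c with r ≟ i
... | yes _ = cong -_ (e r c)
... | no _ = e r c

add-cong : ∀ {d} (i j : Fin d) x {A B : Mat d} → A ≈ B → addRow i j x A ≈ addRow i j x B
add-cong i j x e r c with r ≟ i
... | yes _ = cong₂ _+_ (e r c) (cong (x *_) (e j c))
... | no _ = e r c

swap-· : ∀ {d} (i j : Fin d) X Y → swapRows i j X · Y ≈ swapRows i j (X · Y)
swap-· {d} i j X Y r c =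
  trans (Σ-cong d (λ k → cong (_* Y k c) (swap-entry i j X r k))) (sym (swap-entry i j (X · Y) r c))

neg-· : ∀ {d} (i : Fin d) X Y → negRow i X · Y ≈ negRow i (X · Y)
neg-· {d} i X Y r c = by-cases (r ≟ i)
  where
  by-cases : Dec (r ≡ i) → (negRow i X · Y) r c ≡ negRow i (X · Y) r c
  by-cases (yes refl) =
    trans (Σ-cong d (λ k → trans (cong (_* Y k c) (neg-same r X k)) (sym (ℤP.neg-distribˡ-* (X r k) (Y k c)))))
          (trans (Σ-neg d (λ k → X r k * Y k c)) (sym (neg-same r (X · Y) c)))
  by-cases (no r≢i) =
    trans (Σ-cong d (λ k → cong (_* Y k c) (neg-other i X r k r≢i))) (sym (neg-other i (X · Y) r c r≢i))

add-· : ∀ {d} (i j : Fin d) x X Y → addRow i j x X · Y ≈ addRow i j x (X · Y)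
add-· {d} i j x X Y r c = by-cases (r ≟ i)
  where
  distrib : ∀ x a b y → (a + x * b) * y ≡ a * y + x * (b * y)
  distrib = solve-∀
  by-cases : Dec (r ≡ i) → (addRow i j x X · Y) r c ≡ addRow i j x (X · Y) r c
  by-cases (yes refl) =
    trans (Σ-cong d (λ k → trans (cong (_* Y k c) (add-same r j x X k)) (distrib x (X r k) (X j k) (Y k c))))
    (trans (Σ-+ d (λ k → X r k * Y k c) (λ k → x * (X j k * Y k c)))
    (trans (cong (_+_ ((X · Y) r c)) (Σ-*ˡ d x (λ k → X j k * Y k c))) (sym (add-same r j x (X · Y) c))))
  by-cases (no r≢i) =
    trans (Σ-cong d (λ k → cong (_* Y k c) (add-other i j x X r k r≢i))) (sym (add-other i j x (X · Y) r c r≢i))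

swap-swap : ∀ {d} (i j : Fin d) A → swapRows i j (swapRows i j A) ≈ A
swap-swap i j A r c =
  trans (swap-entry i j (swapRows i j A) r c)
        (trans (swap-entry i j A (tr i j r) c) (cong (λ z → A z c) (tr-involutive i j r)))

neg-neg : ∀ {d} (i : Fin d) A → negRow i (negRow i A) ≈ A
neg-neg i A r c with r ≟ i
... | yes refl = trans (cong -_ (neg-same r A c)) (ℤP.neg-involutive _)
... | no r≢i = neg-other i A r c r≢i

add-add : ∀ {d} (i j : Fin d) x y → x + y ≡ 0ℤ → i ≢ j → ∀ A → addRow i j y (addRow i j x A) ≈ A
add-add i j x y x+y≡0 i≢j A r c = by-cases (r ≟ i)
  where
  cancel : ∀ x y a b → x + y ≡ 0ℤ → a + x * b + y * b ≡ a
  cancel x y a b e = trans (regroup x y a b) (trans (cong (λ s → a + s * b) e) (drop-zero a b))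
    where
    regroup : ∀ x y a b → a + x * b + y * b ≡ a + (x + y) * b
    regroup = solve-∀
    drop-zero : ∀ a b → a + 0ℤ * b ≡ a
    drop-zero = solve-∀
  by-cases : Dec (r ≡ i) → addRow i j y (addRow i j x A) r c ≡ A r c
  by-cases (yes refl) =
    trans (add-same r j y (addRow r j x A) c)
    (trans (cong₂ (λ u v → u + y * v) (add-same r j x A c) (add-other r j x A j c (i≢j ∘ sym)))
           (cancel x y (A r c) (A j c) x+y≡0))
  by-cases (no r≢i) = trans (add-other i j y (addRow i j x A) r c r≢i) (add-other i j x A r c r≢i)

record RowOperation (d : ℕ) : Set where
  field
    apply undo : Mat d → Mat d
    apply-cong : ∀ {A B} → A ≈ B → apply A ≈ apply B
    undo-cong : ∀ {A B} → A ≈ B → undo A ≈ undo B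
    apply-· : ∀ X Y → apply X · Y ≈ apply (X · Y)
    undo-· : ∀ X Y → undo X · Y ≈ undo (X · Y)
    undo-apply : ∀ A → undo (apply A) ≈ A
    apply-undo : ∀ A → apply (undo A) ≈ A

  as-product : ∀ A → apply A ≈ apply I · A
  as-product A = ≈-trans (apply-cong (≈-sym (·-identityˡ A))) (≈-sym (apply-· I A))

  matrix-invertible : Invertible (apply I)
  matrix-invertible = undo I , right , left
    where
    right : apply I · undo I ≈ I
    right = ≈-trans (apply-· I (undo I)) (≈-trans (apply-cong (·-identityˡ (undo I))) (apply-undo I))
    left : undo I · apply I ≈ I
    left = ≈-trans (undo-· I (apply I)) (≈-trans (undo-cong (·-identityˡ (apply I))) (undo-apply I))

swap-op : ∀ {d} → Fin d → Fin d → RowOperation d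
swap-op i j = record
  { apply = swapRows i j ; undo = swapRows i j
  ; apply-cong = swap-cong i j ; undo-cong = swap-cong i j
  ; apply-· = swap-· i j ; undo-· = swap-· i j
  ; undo-apply = swap-swap i j ; apply-undo = swap-swap i j }

neg-op : ∀ {d} → Fin d → RowOperation d
neg-op i = record
  { apply = negRow i ; undo = negRow i
  ; apply-cong = neg-cong i ; undo-cong = neg-cong i
  ; apply-· = neg-· i ; undo-· = neg-· i
  ; undo-apply = neg-neg i ; apply-undo = neg-neg i }

add-op : ∀ {d} (i j : Fin d) → ℤ → i ≢ j → RowOperation d
add-op i j x i≢j = record
  { apply = addRow i j x ; undo = addRow i j (- x)
  ; apply-cong = add-cong i j x ; undo-cong = add-cong i j (- x)
  ; apply-· = add-· i j x ; undo-· = add-· i j (- x)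
  ; undo-apply = add-add i j x (- x) (ℤP.+-inverseʳ x) i≢j
  ; apply-undo = add-add i j (- x) x (ℤP.+-inverseˡ x) i≢j }

column-as-product : ∀ {d} (R : RowOperation d) A →
  transpose (RowOperation.apply R (transpose A)) ≈ A · transpose (RowOperation.apply R I)
column-as-product {d} R A i j =
  trans (RowOperation.as-product R (transpose A) j i) (Σ-cong d (λ k → ℤP.*-comm _ (A i k)))

record _≅_ {d} (A B : Mat d) : Set where
  field
    P Q : Mat d
    P-invertible : Invertible P
    Q-invertible : Invertible Q
    factorisation : B ≈ P · (A · Q)

≅-from-≈ : ∀ {d} {A B : Mat d} → A ≈ B → A ≅ B
≅-from-≈ {A = A} {B} e = record
  { P = I ; Q = I ; P-invertible = I-invertible ; Q-invertible = I-invertible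
  ; factorisation = ≈-trans (≈-sym e) (≈-sym (≈-trans (·-identityˡ (A · I)) (·-identityʳ A))) }

≅-trans : ∀ {d} {A B C : Mat d} → A ≅ B → B ≅ C → A ≅ C
≅-trans {A = A} {B} {C} AB BC = record
  { P = P₂ · P₁ ; Q = Q₁ · Q₂
  ; P-invertible = ·-invertible (_≅_.P-invertible BC) (_≅_.P-invertible AB)
  ; Q-invertible = ·-invertible (_≅_.Q-invertible AB) (_≅_.Q-invertible BC)
  ; factorisation = chain }
  where
  open _≅_ AB renaming (P to P₁; Q to Q₁; factorisation to B≈)
  open _≅_ BC renaming (P to P₂; Q to Q₂; factorisation to C≈)
  open ≈-Reasoning
  chain : C ≈ (P₂ · P₁) · (A · (Q₁ · Q₂))
  chain = begin
    C                                 ≈⟨ C≈ ⟩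
    P₂ · (B · Q₂)                     ≈⟨ ·-congʳ P₂ (·-congˡ Q₂ B≈) ⟩
    P₂ · ((P₁ · (A · Q₁)) · Q₂)       ≈⟨ ·-congʳ P₂ (·-assoc P₁ (A · Q₁) Q₂) ⟩
    P₂ · (P₁ · ((A · Q₁) · Q₂))       ≈⟨ ·-congʳ P₂ (·-congʳ P₁ (·-assoc A Q₁ Q₂)) ⟩
    P₂ · (P₁ · (A · (Q₁ · Q₂)))       ≈⟨ ≈-sym (·-assoc P₂ P₁ (A · (Q₁ · Q₂))) ⟩
    (P₂ · P₁) · (A · (Q₁ · Q₂))       ∎

row-≅ : ∀ {d} (R : RowOperation d) A → A ≅ RowOperation.apply R A
row-≅ R A = record
  { P = RowOperation.apply R I ; Q = I
  ; P-invertible = RowOperation.matrix-invertible R ; Q-invertible = I-invertible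
  ; factorisation = ≈-trans (RowOperation.as-product R A) (·-congʳ (RowOperation.apply R I) (≈-sym (·-identityʳ A))) }

column-≅ : ∀ {d} (R : RowOperation d) A → A ≅ transpose (RowOperation.apply R (transpose A))
column-≅ R A = record
  { P = I ; Q = transpose (RowOperation.apply R I)
  ; P-invertible = I-invertible ; Q-invertible = transpose-invertible (RowOperation.matrix-invertible R)
  ; factorisation = ≈-trans (column-as-product R A) (≈-sym (·-identityˡ _)) }

step-≅ : ∀ {d} {A B : Mat d} → ElemStep A B → A ≅ B
step-≅ (rowSwap A i j) = row-≅ (swap-op i j) A
step-≅ (rowNeg A i) = row-≅ (neg-op i) A
step-≅ (rowAdd A i j c i≢j) = row-≅ (add-op i j c i≢j) A
step-≅ (colSwap A i j) = column-≅ (swap-op i j) A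
step-≅ (colNeg A i) = column-≅ (neg-op i) A
step-≅ (colAdd A i j c i≢j) = column-≅ (add-op i j c i≢j) A

∼-≅ : ∀ {d} {A B : Mat d} → A ∼ B → A ≅ B
∼-≅ (done e) = ≅-from-≈ e
∼-≅ (step s rest) = ≅-trans (step-≅ s) (∼-≅ rest)

≅-sym : ∀ {d} {A B : Mat d} → A ≅ B → B ≅ A
≅-sym {A = A} {B} AB = record
  { P = P' ; Q = Q'
  ; P-invertible = P , P'P , PP'
  ; Q-invertible = Q , Q'Q , QQ'
  ; factorisation = chain }
  where
  open _≅_ AB
  P' = proj₁ P-invertible
  PP' = proj₁ (proj₂ P-invertible)
  P'P = proj₂ (proj₂ P-invertible)
  Q' = proj₁ Q-invertible
  QQ' = proj₁ (proj₂ Q-invertible)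
  Q'Q = proj₂ (proj₂ Q-invertible)
  open ≈-Reasoning
  chain : A ≈ P' · (B · Q')
  chain = ≈-sym (begin
    P' · (B · Q')                 ≈⟨ ·-congʳ P' (·-congˡ Q' factorisation) ⟩
    P' · ((P · (A · Q)) · Q')     ≈⟨ ·-congʳ P' (·-assoc P (A · Q) Q') ⟩
    P' · (P · ((A · Q) · Q'))     ≈⟨ ≈-sym (·-assoc P' P ((A · Q) · Q')) ⟩
    (P' · P) · ((A · Q) · Q')     ≈⟨ ·-congˡ ((A · Q) · Q') P'P ⟩
    I · ((A · Q) · Q')            ≈⟨ ·-identityˡ ((A · Q) · Q') ⟩
    (A · Q) · Q'                  ≈⟨ ·-assoc A Q Q' ⟩
    A · (Q · Q')                  ≈⟨ ·-congʳ A QQ' ⟩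
    A · I                         ≈⟨ ·-identityʳ A ⟩
    A                             ∎)

-- A has trivial kernel: A · X ≈ O only for X ≈ O.  (Over ℤ this is the content of det A ≠ 0.)
TrivialKernel : ∀ {d} → Mat d → Set
TrivialKernel {d} A = ∀ (X : Mat d) → A · X ≈ O → X ≈ O

kernel-≈ : ∀ {d} {A B : Mat d} → A ≈ B → TrivialKernel A → TrivialKernel B
kernel-≈ {B = B} e tk X BX≈O = tk X (≈-trans (·-congˡ X e) BX≈O)

kernel-left : ∀ {d} {U X : Mat d} → Invertible U → TrivialKernel X → TrivialKernel (U · X)
kernel-left {U = U} {X} (U' , _ , U'U) tk Y UXY≈O = tk Y (begin
  X · Y              ≈⟨ ≈-sym (·-identityˡ (X · Y)) ⟩
  I · (X · Y)        ≈⟨ ·-congˡ (X · Y) (≈-sym U'U) ⟩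
  (U' · U) · (X · Y) ≈⟨ ·-assoc U' U (X · Y) ⟩
  U' · (U · (X · Y)) ≈⟨ ·-congʳ U' (≈-sym (·-assoc U X Y)) ⟩
  U' · ((U · X) · Y) ≈⟨ ·-congʳ U' UXY≈O ⟩
  U' · O             ≈⟨ ·-zeroʳ U' ⟩
  O                  ∎)
  where open ≈-Reasoning

kernel-right : ∀ {d} {U X : Mat d} → Invertible U → TrivialKernel X → TrivialKernel (X · U)
kernel-right {U = U} {X} (U' , _ , U'U) tk Y XUY≈O = begin
  Y              ≈⟨ ≈-sym (·-identityˡ Y) ⟩
  I · Y          ≈⟨ ·-congˡ Y (≈-sym U'U) ⟩
  (U' · U) · Y   ≈⟨ ·-assoc U' U Y ⟩
  U' · (U · Y)   ≈⟨ ·-congʳ U' (tk (U · Y) (≈-trans (≈-sym (·-assoc X U Y)) XUY≈O)) ⟩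
  U' · O         ≈⟨ ·-zeroʳ U' ⟩
  O              ∎
  where open ≈-Reasoning

kernel-≅ : ∀ {d} {A B : Mat d} → A ≅ B → TrivialKernel A → TrivialKernel B
kernel-≅ {A = A} AB tk =
  kernel-≈ (≈-sym factorisation) (kernel-left {X = A · Q} P-invertible (kernel-right {X = A} Q-invertible tk))
  where open _≅_ AB

-- A is invertible up to the factor 2: some B has A · B ≈ 2I ≈ B · A, i.e. 2A⁻¹ is integral.
TwiceInvertible : ∀ {d} → Mat d → Set
TwiceInvertible {d} A = Σ (Mat d) λ B → A · B ≈ scale (+ 2) I × B · A ≈ scale (+ 2) I

twice-≈ : ∀ {d} {A A' : Mat d} → A ≈ A' → TwiceInvertible A → TwiceInvertible A'
twice-≈ e (B , AB , BA) = B , ≈-trans (·-congˡ B (≈-sym e)) AB , ≈-trans (·-congʳ B (≈-sym e)) BA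

-- Multiplying by a unimodular matrix U: X · 2I · Y ≈ 2 (X · Y) lets U and U⁻¹ cancel.
twice-sandwich : ∀ {d} (X Y : Mat d) → X · (scale (+ 2) I · Y) ≈ scale (+ 2) (X · Y)
twice-sandwich X Y =
  ≈-trans (·-congʳ X (≈-trans (·-scaleˡ (+ 2) I Y) (scale-cong (+ 2) (·-identityˡ Y)))) (·-scaleʳ (+ 2) X Y)

twice-left : ∀ {d} {U X : Mat d} → Invertible U → TwiceInvertible X → TwiceInvertible (U · X)
twice-left {U = U} {X} (U' , UU' , U'U) (C , XC , CX) = C · U' , right , left
  where
  open ≈-Reasoning
  right : (U · X) · (C · U') ≈ scale (+ 2) I
  right = begin
    (U · X) · (C · U') ≈⟨ ·-assoc U X (C · U') ⟩
    U · (X · (C · U')) ≈⟨ ·-congʳ U (≈-sym (·-assoc X C U')) ⟩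
    U · ((X · C) · U') ≈⟨ ·-congʳ U (·-congˡ U' XC) ⟩
    U · (scale (+ 2) I · U') ≈⟨ twice-sandwich U U' ⟩
    scale (+ 2) (U · U') ≈⟨ scale-cong (+ 2) UU' ⟩
    scale (+ 2) I ∎
  left : (C · U') · (U · X) ≈ scale (+ 2) I
  left = begin
    (C · U') · (U · X) ≈⟨ ·-assoc C U' (U · X) ⟩
    C · (U' · (U · X)) ≈⟨ ·-congʳ C (≈-sym (·-assoc U' U X)) ⟩
    C · ((U' · U) · X) ≈⟨ ·-congʳ C (·-congˡ X U'U) ⟩
    C · (I · X)        ≈⟨ ·-congʳ C (·-identityˡ X) ⟩
    C · X              ≈⟨ CX ⟩
    scale (+ 2) I ∎

twice-right : ∀ {d} {U X : Mat d} → Invertible U → TwiceInvertible X → TwiceInvertible (X · U)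
twice-right {U = U} {X} (U' , UU' , U'U) (C , XC , CX) = U' · C , right , left
  where
  open ≈-Reasoning
  right : (X · U) · (U' · C) ≈ scale (+ 2) I
  right = begin
    (X · U) · (U' · C) ≈⟨ ·-assoc X U (U' · C) ⟩
    X · (U · (U' · C)) ≈⟨ ·-congʳ X (≈-sym (·-assoc U U' C)) ⟩
    X · ((U · U') · C) ≈⟨ ·-congʳ X (·-congˡ C UU') ⟩
    X · (I · C)        ≈⟨ ·-congʳ X (·-identityˡ C) ⟩
    X · C              ≈⟨ XC ⟩
    scale (+ 2) I ∎
  left : (U' · C) · (X · U) ≈ scale (+ 2) I
  left = begin
    (U' · C) · (X · U) ≈⟨ ·-assoc U' C (X · U) ⟩
    U' · (C · (X · U)) ≈⟨ ·-congʳ U' (≈-sym (·-assoc C X U)) ⟩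
    U' · ((C · X) · U) ≈⟨ ·-congʳ U' (·-congˡ U CX) ⟩
    U' · (scale (+ 2) I · U) ≈⟨ twice-sandwich U' U ⟩
    scale (+ 2) (U' · U) ≈⟨ scale-cong (+ 2) U'U ⟩
    scale (+ 2) I ∎

twice-≅ : ∀ {d} {A B : Mat d} → A ≅ B → TwiceInvertible A → TwiceInvertible B
twice-≅ {A = A} AB ti =
  twice-≈ (≈-sym factorisation) (twice-left {X = A · Q} P-invertible (twice-right {X = A} Q-invertible ti))
  where open _≅_ AB

step-≈ : ∀ {d} {A A' B : Mat d} → ElemStep A B → A' ≈ A → Σ (Mat d) λ B' → ElemStep A' B' × B' ≈ B
step-≈ {A' = A'} (rowSwap A i j) e = _ , rowSwap A' i j , swap-cong i j e
step-≈ {A' = A'} (rowNeg A i) e = _ , rowNeg A' i , neg-cong i e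
step-≈ {A' = A'} (rowAdd A i j c i≢j) e = _ , rowAdd A' i j c i≢j , add-cong i j c e
step-≈ {A' = A'} (colSwap A i j) e = _ , colSwap A' i j , λ r c → swap-cong i j (λ x y → e y x) c r
step-≈ {A' = A'} (colNeg A i) e = _ , colNeg A' i , λ r c → neg-cong i (λ x y → e y x) c r
step-≈ {A' = A'} (colAdd A i j c i≢j) e = _ , colAdd A' i j c i≢j , λ r k → add-cong i j c (λ x y → e y x) k r

∼-≈ˡ : ∀ {d} {A A' C : Mat d} → A ≈ A' → A' ∼ C → A ∼ C
∼-≈ˡ e (done f) = done (≈-trans e f)
∼-≈ˡ e (step s rest) with step-≈ s e
... | _ , s' , e' = step s' (∼-≈ˡ e' rest)

∼-trans : ∀ {d} {A B C : Mat d} → A ∼ B → B ∼ C → A ∼ C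
∼-trans (done e) q = ∼-≈ˡ e q
∼-trans (step s p) q = step s (∼-trans p q)

∼-≈ʳ : ∀ {d} {A B C : Mat d} → A ∼ B → B ≈ C → A ∼ C
∼-≈ʳ p e = ∼-trans p (done e)

∼-refl : ∀ {d} {A : Mat d} → A ∼ A
∼-refl = done ≈-refl

∼-step : ∀ {d} {A B : Mat d} → ElemStep A B → A ∼ B
∼-step s = step s ∼-refl

step-transpose : ∀ {d} {A B : Mat d} → ElemStep A B → ElemStep (transpose A) (transpose B)
step-transpose (rowSwap A i j) = colSwap (transpose A) i j
step-transpose (rowNeg A i) = colNeg (transpose A) i
step-transpose (rowAdd A i j c i≢j) = colAdd (transpose A) i j c i≢j
step-transpose (colSwap A i j) = rowSwap (transpose A) i j
step-transpose (colNeg A i) = rowNeg (transpose A) i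
step-transpose (colAdd A i j c i≢j) = rowAdd (transpose A) i j c i≢j

∼-transpose : ∀ {d} {A B : Mat d} → A ∼ B → transpose A ∼ transpose B
∼-transpose (done e) = done (λ i j → e j i)
∼-transpose (step s p) = step (step-transpose s) (∼-transpose p)

permute : ∀ {d} → Mat d → Fin d → Fin d → Fin d → Fin d → Mat d
permute N a r b j x y = N (tr a r x) (tr b j y)

permute-∼ : ∀ {d} (N : Mat d) a r b j → N ∼ permute N a r b j
permute-∼ N a r b j = step (rowSwap N a r) (step (colSwap _ b j) (done entries))
  where
  entries : transpose (swapRows b j (transpose (swapRows a r N))) ≈ permute N a r b j
  entries x y = trans (swap-entry b j (transpose (swapRows a r N)) y x) (swap-entry a r N x (tr b j y))

infixr 30 _⊕_
_⊕_ : ∀ {m} → ℤ → Mat m → Mat (suc m)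
(k ⊕ N) zero zero = k
(k ⊕ N) zero (suc j) = 0ℤ
(k ⊕ N) (suc i) zero = 0ℤ
(k ⊕ N) (suc i) (suc j) = N i j

⊕-cong : ∀ {m} k {N N' : Mat m} → N ≈ N' → k ⊕ N ≈ k ⊕ N'
⊕-cong k e zero zero = refl
⊕-cong k e zero (suc j) = refl
⊕-cong k e (suc i) zero = refl
⊕-cong k e (suc i) (suc j) = e i j

⊕-corner : ∀ {m} {k k' : ℤ} (N : Mat m) → k ≡ k' → k ⊕ N ≈ k' ⊕ N
⊕-corner N refl = ≈-refl

⊕-transpose : ∀ {m} k (N : Mat m) → transpose (k ⊕ N) ≈ k ⊕ transpose N
⊕-transpose k N zero zero = refl
⊕-transpose k N zero (suc j) = refl
⊕-transpose k N (suc i) zero = refl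
⊕-transpose k N (suc i) (suc j) = refl

tr-zero : ∀ {m} (i j : Fin m) → tr (suc i) (suc j) zero ≡ zero
tr-zero i j = tr-other (suc i) (suc j) zero (λ ()) (λ ())

⊕-swap : ∀ {m} k (N : Mat m) i j → swapRows (suc i) (suc j) (k ⊕ N) ≈ k ⊕ swapRows i j N
⊕-swap k N i j zero zero = trans (swap-entry (suc i) (suc j) (k ⊕ N) zero zero) (cong (λ r → (k ⊕ N) r zero) (tr-zero i j))
⊕-swap k N i j zero (suc c) =
  trans (swap-entry (suc i) (suc j) (k ⊕ N) zero (suc c)) (cong (λ r → (k ⊕ N) r (suc c)) (tr-zero i j))
⊕-swap k N i j (suc r) zero =
  trans (swap-entry (suc i) (suc j) (k ⊕ N) (suc r) zero) (cong (λ r → (k ⊕ N) r zero) (tr-suc i j r))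
⊕-swap k N i j (suc r) (suc c) = trans (swap-entry (suc i) (suc j) (k ⊕ N) (suc r) (suc c))
  (trans (cong (λ r → (k ⊕ N) r (suc c)) (tr-suc i j r)) (sym (swap-entry i j N r c)))

⊕-neg : ∀ {m} k (N : Mat m) i → negRow (suc i) (k ⊕ N) ≈ k ⊕ negRow i N
⊕-neg k N i zero zero = neg-other (suc i) (k ⊕ N) zero zero (λ ())
⊕-neg k N i zero (suc c) = neg-other (suc i) (k ⊕ N) zero (suc c) (λ ())
⊕-neg k N i (suc r) c = by-cases (r ≟ i) c
  where
  by-cases : Dec (r ≡ i) → ∀ c → negRow (suc i) (k ⊕ N) (suc r) c ≡ (k ⊕ negRow i N) (suc r) c
  by-cases (yes refl) zero = neg-same (suc r) (k ⊕ N) zero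
  by-cases (yes refl) (suc c) = trans (neg-same (suc r) (k ⊕ N) (suc c)) (sym (neg-same r N c))
  by-cases (no r≢i) zero = neg-other (suc i) (k ⊕ N) (suc r) zero (r≢i ∘ FinP.suc-injective)
  by-cases (no r≢i) (suc c) =
    trans (neg-other (suc i) (k ⊕ N) (suc r) (suc c) (r≢i ∘ FinP.suc-injective)) (sym (neg-other i N r c r≢i))

⊕-add : ∀ {m} k (N : Mat m) i j x → addRow (suc i) (suc j) x (k ⊕ N) ≈ k ⊕ addRow i j x N
⊕-add k N i j x zero zero = add-other (suc i) (suc j) x (k ⊕ N) zero zero (λ ())
⊕-add k N i j x zero (suc c) = add-other (suc i) (suc j) x (k ⊕ N) zero (suc c) (λ ())
⊕-add k N i j x (suc r) c = by-cases (r ≟ i) c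
  where
  vanish : ∀ x → 0ℤ + x * 0ℤ ≡ 0ℤ
  vanish = solve-∀
  by-cases : Dec (r ≡ i) → ∀ c → addRow (suc i) (suc j) x (k ⊕ N) (suc r) c ≡ (k ⊕ addRow i j x N) (suc r) c
  by-cases (yes refl) zero = trans (add-same (suc r) (suc j) x (k ⊕ N) zero) (vanish x)
  by-cases (yes refl) (suc c) = trans (add-same (suc r) (suc j) x (k ⊕ N) (suc c)) (sym (add-same r j x N c))
  by-cases (no r≢i) zero = add-other (suc i) (suc j) x (k ⊕ N) (suc r) zero (r≢i ∘ FinP.suc-injective)
  by-cases (no r≢i) (suc c) =
    trans (add-other (suc i) (suc j) x (k ⊕ N) (suc r) (suc c) (r≢i ∘ FinP.suc-injective)) (sym (add-other i j x N r c r≢i))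

⊕-via-transpose : ∀ {m} k (N : Mat m) {F : Mat (suc m) → Mat (suc m)} {G : Mat m → Mat m} →
  (∀ {X Y} → X ≈ Y → F X ≈ F Y) → F (k ⊕ transpose N) ≈ k ⊕ G (transpose N) →
  transpose (F (transpose (k ⊕ N))) ≈ k ⊕ transpose (G (transpose N))
⊕-via-transpose k N {G = G} F-cong e r c =
  trans (F-cong (⊕-transpose k N) c r) (trans (e c r) (⊕-transpose k (G (transpose N)) r c))

step-⊕ : ∀ {m} k {N N₁ : Mat m} → ElemStep N N₁ → Σ (Mat (suc m)) λ B → ElemStep (k ⊕ N) B × B ≈ k ⊕ N₁
step-⊕ k (rowSwap N i j) = _ , rowSwap (k ⊕ N) (suc i) (suc j) , ⊕-swap k N i j
step-⊕ k (rowNeg N i) = _ , rowNeg (k ⊕ N) (suc i) , ⊕-neg k N i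
step-⊕ k (rowAdd N i j c i≢j) = _ , rowAdd (k ⊕ N) (suc i) (suc j) c (i≢j ∘ FinP.suc-injective) , ⊕-add k N i j c
step-⊕ k (colSwap N i j) =
  _ , colSwap (k ⊕ N) (suc i) (suc j) , ⊕-via-transpose k N {G = swapRows i j} (swap-cong (suc i) (suc j)) (⊕-swap k (transpose N) i j)
step-⊕ k (colNeg N i) =
  _ , colNeg (k ⊕ N) (suc i) , ⊕-via-transpose k N {G = negRow i} (neg-cong (suc i)) (⊕-neg k (transpose N) i)
step-⊕ k (colAdd N i j c i≢j) =
  _ , colAdd (k ⊕ N) (suc i) (suc j) c (i≢j ∘ FinP.suc-injective) ,
  ⊕-via-transpose k N {G = addRow i j c} (add-cong (suc i) (suc j) c) (⊕-add k (transpose N) i j c)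

∼-⊕ : ∀ {m} k {N N' : Mat m} → N ∼ N' → k ⊕ N ∼ k ⊕ N'
∼-⊕ k (done e) = done (⊕-cong k e)
∼-⊕ k (step s p) with step-⊕ k s
... | _ , s' , e = step s' (∼-≈ˡ e (∼-⊕ k p))

kernel-⊕ : ∀ {m} k (N : Mat m) → TrivialKernel (k ⊕ N) → TrivialKernel N
kernel-⊕ {m} k N tk X NX≈O i j = tk X' kX'≈O (suc i) (suc j)
  where
  X' : Mat (suc m)
  X' zero _ = 0ℤ
  X' (suc i) zero = 0ℤ
  X' (suc i) (suc j) = X i j
  kX'≈O : (k ⊕ N) · X' ≈ O
  kX'≈O zero c = cong₂ _+_ (ℤP.*-zeroʳ k) (Σ-zero m _ (λ r → ℤP.*-zeroˡ (X' (suc r) c)))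
  kX'≈O (suc i) zero = trans (ℤP.+-identityˡ _) (Σ-zero m _ (λ r → ℤP.*-zeroʳ (N i r)))
  kX'≈O (suc i) (suc j) = trans (ℤP.+-identityˡ _) (NX≈O i j)

minor : ∀ {n} → Fin (suc n) → Mat (suc n) → Mat n
minor j A r c = A (suc r) (punchIn j c)

term : ∀ n → Mat (suc n) → Fin (suc n) → ℤ
term n A j = sgn (toℕ j) * (A zero j * det n (minor j A))

det-cong : ∀ n {A B : Mat n} → A ≈ B → det n A ≡ det n B
det-cong zero e = refl
det-cong (suc n) e = Σ-cong (suc n) λ j →
  cong₂ (λ x y → sgn (toℕ j) * (x * y)) (e zero j) (det-cong n (λ r c → e (suc r) (punchIn j c)))

det-linear : ∀ n (A B C : Mat n) k α β →
  (∀ r c → c ≢ k → A r c ≡ C r c) → (∀ r c → c ≢ k → B r c ≡ C r c) →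
  (∀ r → C r k ≡ α * A r k + β * B r k) → det n C ≡ α * det n A + β * det n B
det-linear (suc n) A B C k α β eA eB eC =
  trans (Σ-cong (suc n) term-linear)
  (trans (Σ-+ (suc n) (λ j → α * term n A j) (λ j → β * term n B j))
         (cong₂ _+_ (Σ-*ˡ (suc n) α (term n A)) (Σ-*ˡ (suc n) β (term n B))))
  where
  term-linear : ∀ j → term n C j ≡ α * term n A j + β * term n B j
  term-linear j with j ≟ k
  -- j = k: the minors agree and the coefficient is linear.
  ... | yes refl =
    trans (cong₂ (λ x y → sgn (toℕ j) * (x * y)) (eC zero) minorC≡A)
    (trans (distrib (sgn (toℕ j)) (A zero j) (B zero j) α β (det n (minor j A)))
           (cong (λ y → α * term n A j + β * (sgn (toℕ j) * (B zero j * y))) (sym minorB≡A)))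
    where
    minorC≡A : det n (minor j C) ≡ det n (minor j A)
    minorC≡A = det-cong n (λ r c → sym (eA (suc r) (punchIn j c) (FinP.punchInᵢ≢i j c)))
    minorB≡A : det n (minor j B) ≡ det n (minor j A)
    minorB≡A = det-cong n (λ r c → trans (eB (suc r) (punchIn j c) (FinP.punchInᵢ≢i j c))
                                          (sym (eA (suc r) (punchIn j c) (FinP.punchInᵢ≢i j c))))
    distrib : ∀ s x y a b D → s * ((a * x + b * y) * D) ≡ a * (s * (x * D)) + b * (s * (y * D))
    distrib = solve-∀
  -- j ≠ k: the coefficient is common and the minors are linear in column punchOut k.
  ... | no j≢k =
    trans (cong₂ (λ x y → sgn (toℕ j) * (x * y)) (sym (eA zero j j≢k)) minor-linear)
    (trans (distrib (sgn (toℕ j)) (A zero j) (det n (minor j A)) (det n (minor j B)) α β)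
           (cong (λ z → α * term n A j + β * (sgn (toℕ j) * (z * det n (minor j B))))
                 (trans (eA zero j j≢k) (sym (eB zero j j≢k)))))
    where
    k' = punchOut j≢k
    avoids : ∀ c → c ≢ k' → punchIn j c ≢ k
    avoids c c≢k' e = c≢k' (FinP.punchIn-injective j c k' (trans e (sym (FinP.punchIn-punchOut j≢k))))
    minor-linear : det n (minor j C) ≡ α * det n (minor j A) + β * det n (minor j B)
    minor-linear = det-linear n (minor j A) (minor j B) (minor j C) k' α β
      (λ r c c≢k' → eA (suc r) (punchIn j c) (avoids c c≢k'))
      (λ r c c≢k' → eB (suc r) (punchIn j c) (avoids c c≢k'))
      (λ r → subst (λ z → C (suc r) z ≡ α * A (suc r) z + β * B (suc r) z) (sym (FinP.punchIn-punchOut j≢k)) (eC (suc r)))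
    distrib : ∀ s a x y α β → s * (a * (α * x + β * y)) ≡ α * (s * (a * x)) + β * (s * (a * y))
    distrib = solve-∀

adj : ∀ {n} → Fin n → Fin (suc n) → Fin (suc n)
adj zero zero = suc zero
adj zero (suc zero) = zero
adj zero (suc (suc x)) = suc (suc x)
adj (suc q) zero = zero
adj (suc q) (suc x) = suc (adj q x)

adj-left : ∀ {n} (q : Fin n) → adj q (inject₁ q) ≡ suc q
adj-left zero = refl
adj-left (suc q) = cong suc (adj-left q)

adj-right : ∀ {n} (q : Fin n) → adj q (suc q) ≡ inject₁ q
adj-right zero = refl
adj-right (suc q) = cong suc (adj-right q)

adj-punch-left : ∀ {n} (q : Fin n) c → adj q (punchIn (inject₁ q) c) ≡ punchIn (suc q) c
adj-punch-left zero zero = refl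
adj-punch-left zero (suc c) = refl
adj-punch-left (suc q) zero = refl
adj-punch-left (suc q) (suc c) = cong suc (adj-punch-left q c)

adj-punch-right : ∀ {n} (q : Fin n) c → adj q (punchIn (suc q) c) ≡ punchIn (inject₁ q) c
adj-punch-right zero zero = refl
adj-punch-right zero (suc c) = refl
adj-punch-right (suc q) zero = refl
adj-punch-right (suc q) (suc c) = cong suc (adj-punch-right q c)

adj-other : ∀ {n} (q : Fin n) j → j ≢ inject₁ q → j ≢ suc q → adj q j ≡ j
adj-other zero zero a b = ⊥-elim (a refl)
adj-other zero (suc zero) a b = ⊥-elim (b refl)
adj-other zero (suc (suc j)) a b = refl
adj-other (suc q) zero a b = refl
adj-other (suc q) (suc j) a b = cong suc (adj-other q j (a ∘ cong suc) (b ∘ cong suc))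

adj-punch-far : ∀ {n} (q : Fin (suc n)) (j : Fin (suc (suc n))) → j ≢ inject₁ q → j ≢ suc q →
  Σ (Fin n) λ q' → ∀ c → adj q (punchIn j c) ≡ punchIn j (adj q' c)
adj-punch-far {zero} zero zero a b = ⊥-elim (a refl)
adj-punch-far {zero} zero (suc zero) a b = ⊥-elim (b refl)
adj-punch-far {suc n} zero zero a b = ⊥-elim (a refl)
adj-punch-far {suc n} zero (suc zero) a b = ⊥-elim (b refl)
adj-punch-far {suc n} zero (suc (suc j)) a b = zero , commute
  where
  commute : ∀ c → adj zero (punchIn (suc (suc j)) c) ≡ punchIn (suc (suc j)) (adj zero c)
  commute zero = refl
  commute (suc zero) = refl
  commute (suc (suc c)) = refl
adj-punch-far {suc n} (suc q) zero a b = q , λ c → refl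
adj-punch-far {suc n} (suc q) (suc j) a b with adj-punch-far q j (a ∘ cong suc) (b ∘ cong suc)
... | q' , commute = suc q' , commute'
  where
  commute' : ∀ c → adj (suc q) (punchIn (suc j) c) ≡ punchIn (suc j) (adj (suc q') c)
  commute' zero = refl
  commute' (suc c) = cong suc (commute c)

Σ-adj : ∀ n (f : Fin (suc n) → ℤ) q → Σ[ suc n ] (λ j → f (adj q j)) ≡ Σ[ suc n ] f
Σ-adj (suc n) f zero = exchange (f zero) (f (suc zero)) (Σ[ n ] (λ i → f (suc (suc i))))
  where
  exchange : ∀ a b x → b + (a + x) ≡ a + (b + x)
  exchange = solve-∀
Σ-adj (suc n) f (suc q) = cong (_+_ (f zero)) (Σ-adj n (λ i → f (suc i)) q)

sgn-adj : ∀ {n} (q : Fin n) → sgn (toℕ (inject₁ q)) ≡ - sgn (toℕ (suc q))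
sgn-adj q rewrite FinP.toℕ-inject₁ q = sym (ℤP.neg-involutive _)

det-adj : ∀ n (A : Mat (suc n)) (q : Fin n) → det (suc n) (λ r c → A r (adj q c)) ≡ - det (suc n) A
det-adj (suc n) A q =
  trans (Σ-cong (suc (suc n)) term-adj)
  (trans (Σ-neg (suc (suc n)) (λ j → term (suc n) A (adj q j))) (cong -_ (Σ-adj (suc n) (term (suc n) A) q)))
  where
  A' : Mat (suc (suc n))
  A' r c = A r (adj q c)
  neg-outer : ∀ s x y → (- s) * (x * y) ≡ - (s * (x * y))
  neg-outer = solve-∀
  neg-inner : ∀ s x y → s * (x * (- y)) ≡ - (s * (x * y))
  neg-inner = solve-∀
  term-adj : ∀ j → term (suc n) A' j ≡ - term (suc n) A (adj q j)
  term-adj j with j ≟ inject₁ q | j ≟ suc q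
  -- the two swapped columns exchange their terms, with the sign flipped
  ... | yes refl | _ =
    trans (cong₂ _*_ (sgn-adj q)
            (cong₂ _*_ (cong (A zero) (adj-left q)) (det-cong (suc n) (λ r c → cong (A (suc r)) (adj-punch-left q c)))))
    (trans (neg-outer (sgn (toℕ (suc q))) (A zero (suc q)) (det (suc n) (minor (suc q) A)))
           (cong (λ w → - term (suc n) A w) (sym (adj-left q))))
  ... | no _ | yes refl =
    trans (cong₂ _*_ (sym (trans (cong -_ (sgn-adj q)) (ℤP.neg-involutive _)))
            (cong₂ _*_ (cong (A zero) (adj-right q)) (det-cong (suc n) (λ r c → cong (A (suc r)) (adj-punch-right q c)))))
    (trans (neg-outer (sgn (toℕ (inject₁ q))) (A zero (inject₁ q)) (det (suc n) (minor (inject₁ q) A)))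
           (cong (λ w → - term (suc n) A w) (sym (adj-right q))))
  -- any other term keeps its coefficient, and its minor has two adjacent columns swapped
  ... | no a | no b with adj-punch-far q j a b
  ... | q' , commute =
    trans (cong (λ z → sgn (toℕ j) * (A zero (adj q j) * z))
                (trans (det-cong (suc n) (λ r c → cong (A (suc r)) (commute c))) (det-adj n (minor j A) q')))
    (trans (neg-inner (sgn (toℕ j)) (A zero (adj q j)) (det (suc n) (minor j A)))
    (trans (cong (λ z → - (sgn (toℕ j) * (A zero z * det (suc n) (minor j A)))) (adj-other q j a b))
           (cong (λ w → - term (suc n) A w) (sym (adj-other q j a b)))))

self-negative : ∀ x → x ≡ - x → x ≡ 0ℤ
self-negative (+ zero) e = refl
self-negative (+ suc n) ()
self-negative -[1+ n ] ()

-- Two equal adjacent columns give determinant 0 (it equals its negative).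
det-adj-equal : ∀ n (A : Mat (suc n)) (q : Fin n) → (∀ r → A r (inject₁ q) ≡ A r (suc q)) → det (suc n) A ≡ 0ℤ
det-adj-equal n A q e = self-negative _ (trans (sym (det-cong (suc n) unchanged)) (det-adj n A q))
  where
  unchanged : (λ r c → A r (adj q c)) ≈ A
  unchanged r c with c ≟ inject₁ q | c ≟ suc q
  ... | yes refl | _ = trans (cong (A r) (adj-left q)) (sym (e r))
  ... | no _ | yes refl = trans (cong (A r) (adj-right q)) (e r)
  ... | no a | no b = cong (A r) (adj-other q c a b)

-- Equal columns k and q+1 at distance g+1: move column q+1 next to k by adjacent swaps.
det-equal-at-distance : ∀ g n (A : Mat (suc n)) (k : Fin (suc n)) (q : Fin n) → toℕ q ≡ toℕ k +ℕ g →
  (∀ r → A r k ≡ A r (suc q)) → det (suc n) A ≡ 0ℤ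
det-equal-at-distance zero n A k q dist e = det-adj-equal n A q (λ r → trans (cong (A r) (sym k≡q)) (e r))
  where
  k≡q : k ≡ inject₁ q
  k≡q = FinP.toℕ-injective (trans (sym (ℕP.+-identityʳ _)) (trans (sym dist) (sym (FinP.toℕ-inject₁ q))))
det-equal-at-distance (suc g) n A k zero dist e = ⊥-elim (ℕP.0≢1+n (trans dist (ℕP.+-suc (toℕ k) g)))
det-equal-at-distance (suc g) (suc n) A k (suc q) dist e =
  trans (sym (ℤP.neg-involutive _)) (trans (cong -_ (sym (det-adj (suc n) A (suc q))))
    (cong -_ (det-equal-at-distance g (suc n) A' k (inject₁ q) dist' e')))
  where
  A' : Mat (suc (suc n))
  A' r c = A r (adj (suc q) c)
  q-dist : toℕ q ≡ toℕ k +ℕ g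
  q-dist = ℕP.suc-injective (trans dist (ℕP.+-suc (toℕ k) g))
  dist' : toℕ (inject₁ q) ≡ toℕ k +ℕ g
  dist' = trans (FinP.toℕ-inject₁ q) q-dist
  k<1+q : toℕ k < toℕ (suc q)
  k<1+q = s≤s (subst (toℕ k ≤_) (sym q-dist) (ℕP.m≤m+n (toℕ k) g))
  k≢left : k ≢ inject₁ (suc q)
  k≢left eq = ℕP.<-irrefl (trans (cong toℕ eq) (FinP.toℕ-inject₁ (suc q))) k<1+q
  k≢right : k ≢ suc (suc q)
  k≢right eq = ℕP.<-irrefl refl (ℕP.<-trans k<1+q (subst (λ z → toℕ (suc q) < toℕ z) (sym eq) (ℕP.n<1+n _)))
  e' : ∀ r → A' r k ≡ A' r (suc (inject₁ q))
  e' r = trans (cong (A r) (adj-other (suc q) k k≢left k≢right)) (trans (e r) (sym (cong (A r) (adj-left (suc q)))))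

det-equal-ordered : ∀ n (A : Mat n) (k l : Fin n) → toℕ k < toℕ l → (∀ r → A r k ≡ A r l) → det n A ≡ 0ℤ
det-equal-ordered (suc n) A k (suc q) (s≤s lt) e with ℕP.m≤n⇒∃[o]m+o≡n lt
... | g , eq = det-equal-at-distance g n A k q (sym eq) e

det-equal-columns : ∀ n (A : Mat n) (k l : Fin n) → k ≢ l → (∀ r → A r k ≡ A r l) → det n A ≡ 0ℤ
det-equal-columns n A k l k≢l e with ℕP.<-cmp (toℕ k) (toℕ l)
... | tri≈ _ eq _ = ⊥-elim (k≢l (FinP.toℕ-injective eq))
... | tri< lt _ _ = det-equal-ordered n A k l lt e
... | tri> _ _ gt = det-equal-ordered n A l k gt (λ r → sym (e r))

setCol : ∀ {n} → Fin n → (Fin n → ℤ) → Mat n → Mat n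
setCol k v A r c with c ≟ k
... | yes _ = v r
... | no _ = A r c

setCol-same : ∀ {n} (k : Fin n) v (A : Mat n) r → setCol k v A r k ≡ v r
setCol-same k v A r with k ≟ k
... | yes _ = refl
... | no k≢k = ⊥-elim (k≢k refl)

setCol-other : ∀ {n} (k : Fin n) v (A : Mat n) r c → c ≢ k → setCol k v A r c ≡ A r c
setCol-other k v A r c c≢k with c ≟ k
... | yes c≡k = ⊥-elim (c≢k c≡k)
... | no _ = refl

setCol-agree : ∀ {n} (k : Fin n) v w (A : Mat n) r c → c ≢ k → setCol k v A r c ≡ setCol k w A r c
setCol-agree k v w A r c c≢k = trans (setCol-other k v A r c c≢k) (sym (setCol-other k w A r c c≢k))

det-zero-column : ∀ n (C : Mat n) k → (∀ r → C r k ≡ 0ℤ) → det n C ≡ 0ℤ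
det-zero-column n C k z =
  trans (det-linear n C C C k 0ℤ 0ℤ (λ r c _ → refl) (λ r c _ → refl) (λ r → trans (z r) (sym (vanish (C r k)))))
        (vanish (det n C))
  where
  vanish : ∀ y → 0ℤ * y + 0ℤ * y ≡ 0ℤ
  vanish = solve-∀

det-column-combination : ∀ m n (f : Fin m → Fin n) (x : Fin m → ℤ) k (A : Mat n) →
  det n (setCol k (λ r → Σ[ m ] (λ i → x i * A r (f i))) A) ≡
  Σ[ m ] (λ i → x i * det n (setCol k (λ r → A r (f i)) A))
det-column-combination zero n f x k A = det-zero-column n _ k (λ r → setCol-same k (λ r → 0ℤ) A r)
det-column-combination (suc m) n f x k A =
  trans (det-linear n first rest combined k (x zero) 1ℤ
          (setCol-agree k _ _ A) (setCol-agree k _ _ A)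
          (λ r → trans (setCol-same k _ A r)
             (cong₂ _+_ (cong (x zero *_) (sym (setCol-same k _ A r)))
               (trans (sym (ℤP.*-identityˡ _)) (cong (1ℤ *_) (sym (setCol-same k _ A r)))))))
   (cong (_+_ (x zero * det n first))
         (trans (ℤP.*-identityˡ _) (det-column-combination m n (λ i → f (suc i)) (λ i → x (suc i)) k A)))
  where
  first rest combined : Mat n
  first = setCol k (λ r → A r (f zero)) A
  rest = setCol k (λ r → Σ[ m ] (λ i → x (suc i) * A r (f (suc i)))) A
  combined = setCol k (λ r → Σ[ suc m ] (λ i → x i * A r (f i))) A

-- Cramer's rule in the form x_k · det A = det (A with column k replaced by A x); so A x = 0 forces
-- x_k · det A = 0.
cramer : ∀ n (A : Mat n) (x : Fin n → ℤ) → (∀ r → Σ[ n ] (λ i → A r i * x i) ≡ 0ℤ) → ∀ k → x k * det n A ≡ 0ℤ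
cramer n A x Ax≡0 k = trans (sym expand)
  (trans (sym (det-column-combination n n (λ i → i) x k A))
         (det-zero-column n _ k (λ r → trans (setCol-same k _ A r)
                                     (trans (Σ-cong n (λ i → ℤP.*-comm (x i) (A r i))) (Ax≡0 r)))))
  where
  restore : setCol k (λ r → A r k) A ≈ A
  restore r c with c ≟ k
  ... | yes refl = refl
  ... | no _ = refl
  -- only the term i = k survives: the other matrices have two equal columns
  expand : Σ[ n ] (λ i → x i * det n (setCol k (λ r → A r i) A)) ≡ x k * det n A
  expand = trans
    (Σ-single n _ k (λ i i≢k → trans (cong (x i *_) (det-equal-columns n _ k i (i≢k ∘ sym)
                                        (λ r → trans (setCol-same k _ A r) (sym (setCol-other k _ A r i i≢k)))))
                                      (ℤP.*-zeroʳ (x i))))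
    (cong (x k *_) (det-cong n restore))

det≢0⇒trivial-kernel : ∀ n (A : Mat n) → det n A ≢ 0ℤ → TrivialKernel A
det≢0⇒trivial-kernel n A det≢0 X AX≈O k j
  with ℤP.i*j≡0⇒i≡0∨j≡0 (X k j) (cramer n A (λ i → X i j) (λ r → AX≈O r j) k)
... | inj₁ Xkj≡0 = Xkj≡0
... | inj₂ det≡0 = ⊥-elim (det≢0 det≡0)

OffDiagonalZero : ∀ {d} → Mat d → Set
OffDiagonalZero {d} X = ∀ (i j : Fin d) → i ≢ j → X i j ≡ 0ℤ

diagonal-≈ : ∀ {d} {X Y : Mat d} → OffDiagonalZero X → OffDiagonalZero Y → (∀ i → X i i ≡ Y i i) → X ≈ Y
diagonal-≈ {X = X} {Y} offX offY diag i j with i ≟ j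
... | yes refl = diag i
... | no i≢j = trans (offX i j i≢j) (sym (offY i j i≢j))

diagonal-twice : ∀ {d} {X Y : Mat d} → OffDiagonalZero X → OffDiagonalZero Y → (∀ i → X i i * Y i i ≡ + 2) →
  X · Y ≈ scale (+ 2) I
diagonal-twice {d} {X} {Y} offX offY diag i j =
  trans (Σ-single d _ i (λ k k≢i → trans (cong (_* Y k j) (offX i k (k≢i ∘ sym))) (ℤP.*-zeroˡ (Y k j)))) (by-cases (i ≟ j))
  where
  by-cases : Dec (i ≡ j) → X i i * Y i j ≡ + 2 * δ i j
  by-cases (yes refl) = trans (diag i) (sym (cong (+ 2 *_) (δ-same i)))
  by-cases (no i≢j) =
    trans (cong (X i i *_) (offY i j i≢j)) (trans (ℤP.*-zeroʳ (X i i)) (sym (cong (+ 2 *_) (δ-other i j i≢j))))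

dval : ℕ → ℕ → ℤ
dval s k with k <? s
... | yes _ = 1ℤ
... | no _ = + 2

dval-< : ∀ s k → k < s → dval s k ≡ 1ℤ
dval-< s k k<s with k <? s
... | yes _ = refl
... | no k≮s = ⊥-elim (k≮s k<s)

dval-≮ : ∀ s k → ¬ k < s → dval s k ≡ + 2
dval-≮ s k k≮s with k <? s
... | yes k<s = ⊥-elim (k≮s k<s)
... | no _ = refl

dval-suc : ∀ s k → dval (suc s) (suc k) ≡ dval s k
dval-suc s k = by-cases (k <? s)
  where
  by-cases : Dec (k < s) → dval (suc s) (suc k) ≡ dval s k
  by-cases (yes k<s) = trans (dval-< (suc s) (suc k) (s≤s k<s)) (sym (dval-< s k k<s))
  by-cases (no k≮s) = trans (dval-≮ (suc s) (suc k) (λ { (s≤s k<s) → k≮s k<s })) (sym (dval-≮ s k k≮s))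

dval-step : ∀ s k → suc k ≢ s → dval s k ≡ dval s (suc k)
dval-step s k 1+k≢s = by-cases (k <? s)
  where
  by-cases : Dec (k < s) → dval s k ≡ dval s (suc k)
  by-cases (yes k<s) = trans (dval-< s k k<s) (sym (dval-< s (suc k) (ℕP.≤∧≢⇒< k<s 1+k≢s)))
  by-cases (no k≮s) = trans (dval-≮ s k k≮s) (sym (dval-≮ s (suc k) (λ 1+k<s → k≮s (ℕP.<-trans (ℕP.n<1+n k) 1+k<s))))

dval-values : ∀ s k → dval s k ≡ 1ℤ ⊎ dval s k ≡ + 2
dval-values s k with k <? s
... | yes _ = inj₁ refl
... | no _ = inj₂ refl

D-diagonal : ∀ {d} s (i : Fin d) → D s i i ≡ dval s (toℕ i)
D-diagonal s i with i ≟ i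
... | no i≢i = ⊥-elim (i≢i refl)
... | yes _ with toℕ i <? s
...   | yes _ = refl
...   | no _ = refl

D-off : ∀ {d} s → OffDiagonalZero {d} (D s)
D-off s i j i≢j with i ≟ j
... | yes i≡j = ⊥-elim (i≢j i≡j)
... | no _ = refl

⊕-off : ∀ {m} k {N : Mat m} → OffDiagonalZero N → OffDiagonalZero (k ⊕ N)
⊕-off k offN zero zero 0≢0 = ⊥-elim (0≢0 refl)
⊕-off k offN zero (suc y) _ = refl
⊕-off k offN (suc x) zero _ = refl
⊕-off k offN (suc x) (suc y) x≢y = offN x y (x≢y ∘ cong suc)

⊕-D-1 : ∀ {m} s → 1ℤ ⊕ D {m} s ≈ D {suc m} (suc s)
⊕-D-1 {m} s = diagonal-≈ (⊕-off 1ℤ (D-off s)) (D-off (suc s)) diagonal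
  where
  diagonal : ∀ i → (1ℤ ⊕ D s) i i ≡ D (suc s) i i
  diagonal zero = sym (trans (D-diagonal {suc m} (suc s) zero) (dval-< (suc s) 0 (s≤s z≤n)))
  diagonal (suc i) = trans (D-diagonal s i) (sym (trans (D-diagonal (suc s) (suc i)) (dval-suc s (toℕ i))))

-- Moving a leading 2 into position s by swapping rows and columns 0 and s.
⊕-D-2 : ∀ {m} s → s ≤ m → (+ 2) ⊕ D {m} s ∼ D {suc m} s
⊕-D-2 {m} zero _ = done (diagonal-≈ (⊕-off (+ 2) (D-off 0)) (D-off 0) diagonal)
  where
  diagonal : ∀ i → ((+ 2) ⊕ D 0) i i ≡ D 0 i i
  diagonal zero = sym (D-diagonal {suc m} 0 zero)
  diagonal (suc i) = trans (D-diagonal 0 i) (trans (dval-≮ 0 (toℕ i) (λ ())) (sym (D-diagonal 0 (suc i))))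
⊕-D-2 {m} (suc s) s<m = ∼-≈ʳ (permute-∼ X zero p zero p) (diagonal-≈ off-permuted (D-off (suc s)) diagonal)
  where
  X = (+ 2) ⊕ D {m} (suc s)
  p' : Fin m
  p' = fromℕ< s<m
  p : Fin (suc m)
  p = suc p'
  σ = tr zero p
  off-permuted : OffDiagonalZero (permute X zero p zero p)
  off-permuted x y x≢y = ⊕-off (+ 2) (D-off (suc s)) (σ x) (σ y) (x≢y ∘ tr-injective zero p)
  entry : ∀ r → Dec (r ≡ zero) → Dec (r ≡ p) → X (σ r) (σ r) ≡ dval (suc s) (toℕ r)
  entry r (yes refl) _ = trans (cong (λ x → X x x) (tr-i zero p))
    (trans (D-diagonal (suc s) p') (trans (cong (dval (suc s)) (FinP.toℕ-fromℕ< s<m))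
           (trans (dval-< (suc s) s (ℕP.n<1+n s)) (sym (dval-< (suc s) 0 (s≤s z≤n))))))
  entry r (no _) (yes refl) = trans (cong (λ x → X x x) (tr-j zero p))
    (sym (trans (cong (λ k → dval (suc s) (suc k)) (FinP.toℕ-fromℕ< s<m)) (dval-≮ (suc s) (suc s) (ℕP.<-irrefl refl))))
  entry zero (no r≢0) (no _) = ⊥-elim (r≢0 refl)
  entry (suc u) (no r≢0) (no r≢p) = trans (cong (λ x → X x x) (tr-other zero p (suc u) r≢0 r≢p))
    (trans (D-diagonal (suc s) u) (dval-step (suc s) (toℕ u) (λ e → r≢p (cong suc (toℕ-u≡ (ℕP.suc-injective e))))))
    where
    toℕ-u≡ : toℕ u ≡ s → u ≡ p'
    toℕ-u≡ e = FinP.toℕ-injective (trans e (sym (FinP.toℕ-fromℕ< s<m)))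
  diagonal : ∀ r → X (σ r) (σ r) ≡ D (suc s) r r
  diagonal r = trans (entry r (r ≟ zero) (r ≟ p)) (sym (D-diagonal (suc s) r))

-- D s is invertible up to the factor 2: its inverse partner is 3I − D s.
D-twice-invertible : ∀ {d} s → TwiceInvertible {d} (D s)
D-twice-invertible {d} s = D⋆ , diagonal-twice (D-off s) off⋆ (λ i → product {i} (D s i i) (values i)) ,
                                diagonal-twice off⋆ (D-off s) (λ i → trans (ℤP.*-comm _ (D s i i)) (product {i} (D s i i) (values i)))
  where
  D⋆ : Mat d
  D⋆ i j = + 3 * δ i j + - D s i j
  off⋆ : OffDiagonalZero D⋆
  off⋆ i j i≢j = cong₂ (λ x y → + 3 * x + - y) (δ-other i j i≢j) (D-off s i j i≢j)
  values : ∀ i → D s i i ≡ 1ℤ ⊎ D s i i ≡ + 2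
  values i rewrite D-diagonal s i = dval-values s (toℕ i)
  product : ∀ {i} x → x ≡ 1ℤ ⊎ x ≡ + 2 → x * (+ 3 * δ i i + - x) ≡ + 2
  product {i} x values rewrite δ-same i with values
  ... | inj₁ refl = refl
  ... | inj₂ refl = refl

update : ∀ {n} → (Fin n → ℤ) → Fin n → ℤ → Fin n → ℤ
update x k v r with r ≟ k
... | yes _ = v
... | no _ = x r

update-same : ∀ {n} (x : Fin n → ℤ) k v → update x k v k ≡ v
update-same x k v with k ≟ k
... | yes _ = refl
... | no k≢k = ⊥-elim (k≢k refl)

update-other : ∀ {n} (x : Fin n → ℤ) k v r → r ≢ k → update x k v r ≡ x r
update-other x k v r r≢k with r ≟ k
... | yes r≡k = ⊥-elim (r≢k r≡k)
... | no _ = refl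

-- Killing the coefficient at index k of a coefficient vector that vanishes from k+1 on leaves
-- one that vanishes from k on; this drives the inductions performing several column operations.
update-vanishes : ∀ {n} (c : Fin n → ℤ) k (k<n : k < n) →
  (∀ j → suc k ≤ toℕ j → c j ≡ 0ℤ) → ∀ j → k ≤ toℕ j → update c (fromℕ< k<n) 0ℤ j ≡ 0ℤ
update-vanishes c k k<n z j k≤j = by-cases (j ≟ fromℕ< k<n)
  where
  by-cases : Dec (j ≡ fromℕ< k<n) → update c (fromℕ< k<n) 0ℤ j ≡ 0ℤ
  by-cases (yes refl) = update-same c (fromℕ< k<n) 0ℤ
  by-cases (no j≢k) = trans (update-other c (fromℕ< k<n) 0ℤ j j≢k)
    (z j (ℕP.≤∧≢⇒< k≤j (λ e → j≢k (FinP.toℕ-injective (trans (sym e) (sym (FinP.toℕ-fromℕ< k<n)))))))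

sweep-from-0 : ∀ {m} → Mat (suc m) → (Fin m → ℤ) → Mat (suc m)
sweep-from-0 A c r zero = A r zero
sweep-from-0 A c r (suc j) = A r (suc j) + c j * A r zero

-- The sweep is a chain of single column operations, one coefficient at a time.
sweep-from-0-∼ : ∀ {m} (A : Mat (suc m)) (c : Fin m → ℤ) → A ∼ sweep-from-0 A c
sweep-from-0-∼ {m} A c = from m c (λ j m≤j → ⊥-elim (ℕP.<⇒≱ (FinP.toℕ<n j) m≤j))
  where
  -- induction on the number k of coefficients that may be nonzero
  from : ∀ k (c : Fin m → ℤ) → (∀ j → k ≤ toℕ j → c j ≡ 0ℤ) → A ∼ sweep-from-0 A c
  from zero c z = done unchanged
    where
    unchanged : A ≈ sweep-from-0 A c
    unchanged r zero = refl
    unchanged r (suc j) = sym (trans (cong (λ w → A r (suc j) + w * A r zero) (z j z≤n))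
                                     (trans (cong (_+_ (A r (suc j))) (ℤP.*-zeroˡ (A r zero))) (ℤP.+-identityʳ _)))
  from (suc k) c z with k <? m
  ... | no k≮m = from k c (λ j k≤j → ⊥-elim (k≮m (ℕP.≤-<-trans k≤j (FinP.toℕ<n j))))
  ... | yes k<m = ∼-trans (from k c' (update-vanishes c k k<m z))
                          (∼-≈ʳ (∼-step (colAdd (sweep-from-0 A c') (suc j₀) zero (c j₀) (λ ()))) last-step)
    where
    j₀ = fromℕ< k<m
    c' = update c j₀ 0ℤ
    last-step : transpose (addRow (suc j₀) zero (c j₀) (transpose (sweep-from-0 A c'))) ≈ sweep-from-0 A c
    last-step r zero = add-other (suc j₀) zero (c j₀) (transpose (sweep-from-0 A c')) zero r (λ ())
    last-step r (suc j) = by-cases (j ≟ j₀)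
      where
      drop-zero : ∀ a x b → a + 0ℤ * b + x * b ≡ a + x * b
      drop-zero = solve-∀
      by-cases : Dec (j ≡ j₀) →
        transpose (addRow (suc j₀) zero (c j₀) (transpose (sweep-from-0 A c'))) r (suc j) ≡ sweep-from-0 A c r (suc j)
      by-cases (yes refl) = trans (add-same (suc j) zero (c j) (transpose (sweep-from-0 A c')) r)
        (trans (cong (λ w → A r (suc j) + w * A r zero + c j * A r zero) (update-same c j 0ℤ))
               (drop-zero (A r (suc j)) (c j) (A r zero)))
      by-cases (no j≢j₀) =
        trans (add-other (suc j₀) zero (c j₀) (transpose (sweep-from-0 A c')) (suc j) r (j≢j₀ ∘ FinP.suc-injective))
              (cong (λ w → A r (suc j) + w * A r zero) (update-other c j₀ 0ℤ j j≢j₀))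

sweep-into-last : ∀ {n} → Mat (suc n) → (Fin n → ℤ) → Mat (suc n)
sweep-into-last {n} A c r col with col ≟ fromℕ n
... | yes _ = A r col + Σ[ n ] (λ j → c j * A r (inject₁ j))
... | no _ = A r col

sweep-into-last-last : ∀ {n} (A : Mat (suc n)) c r →
  sweep-into-last A c r (fromℕ n) ≡ A r (fromℕ n) + Σ[ n ] (λ j → c j * A r (inject₁ j))
sweep-into-last-last {n} A c r with fromℕ n ≟ fromℕ n
... | yes _ = refl
... | no ≢ = ⊥-elim (≢ refl)

sweep-into-last-other : ∀ {n} (A : Mat (suc n)) c r col → col ≢ fromℕ n → sweep-into-last A c r col ≡ A r col
sweep-into-last-other {n} A c r col col≢ with col ≟ fromℕ n
... | yes col≡ = ⊥-elim (col≢ col≡)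
... | no _ = refl

sweep-into-last-∼ : ∀ {n} (A : Mat (suc n)) (c : Fin n → ℤ) → A ∼ sweep-into-last A c
sweep-into-last-∼ {n} A c = from n c (λ j n≤j → ⊥-elim (ℕP.<⇒≱ (FinP.toℕ<n j) n≤j))
  where
  from : ∀ k (c : Fin n → ℤ) → (∀ j → k ≤ toℕ j → c j ≡ 0ℤ) → A ∼ sweep-into-last A c
  from zero c z = done unchanged
    where
    unchanged : A ≈ sweep-into-last A c
    unchanged r col with col ≟ fromℕ n
    ... | yes _ = sym (trans (cong (_+_ (A r col)) (Σ-zero n _ (λ j → trans (cong (_* A r (inject₁ j)) (z j z≤n))
                                                                              (ℤP.*-zeroˡ (A r (inject₁ j))))))
                             (ℤP.+-identityʳ _))
    ... | no _ = refl
  from (suc k) c z with k <? n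
  ... | no k≮n = from k c (λ j k≤j → ⊥-elim (k≮n (ℕP.≤-<-trans k≤j (FinP.toℕ<n j))))
  ... | yes k<n = ∼-trans (from k c' (update-vanishes c k k<n z))
      (∼-≈ʳ (∼-step (colAdd B (fromℕ n) (inject₁ j₀) (c j₀) FinP.fromℕ≢inject₁)) last-step)
    where
    j₀ = fromℕ< k<n
    c' = update c j₀ 0ℤ
    B = sweep-into-last A c'
    last-step : transpose (addRow (fromℕ n) (inject₁ j₀) (c j₀) (transpose B)) ≈ sweep-into-last A c
    last-step r col = by-cases (col ≟ fromℕ n)
      where
      old new : Fin n → ℤ
      old j = c' j * A r (inject₁ j)
      new j = c j * A r (inject₁ j)
      old-j₀ : old j₀ ≡ 0ℤ
      old-j₀ = trans (cong (_* A r (inject₁ j₀)) (update-same c j₀ 0ℤ)) (ℤP.*-zeroˡ (A r (inject₁ j₀)))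
      sums : Σ[ n ] old + new j₀ ≡ Σ[ n ] new
      sums = trans (sym (Σ-update n old new j₀ (λ j j≢j₀ → cong (_* A r (inject₁ j)) (update-other c j₀ 0ℤ j j≢j₀))))
                   (trans (cong (_+_ (Σ[ n ] new)) old-j₀) (ℤP.+-identityʳ _))
      by-cases : Dec (col ≡ fromℕ n) →
        transpose (addRow (fromℕ n) (inject₁ j₀) (c j₀) (transpose B)) r col ≡ sweep-into-last A c r col
      by-cases (yes refl) = trans (add-same (fromℕ n) (inject₁ j₀) (c j₀) (transpose B) r)
        (trans (cong₂ (λ u w → u + c j₀ * w) (sweep-into-last-last A c' r)
                      (sweep-into-last-other A c' r (inject₁ j₀) (FinP.fromℕ≢inject₁ ∘ sym)))
        (trans (trans (ℤP.+-assoc (A r (fromℕ n)) _ _) (cong (_+_ (A r (fromℕ n))) sums))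
               (sym (sweep-into-last-last A c r))))
      by-cases (no col≢) = trans (add-other (fromℕ n) (inject₁ j₀) (c j₀) (transpose B) col r col≢)
        (trans (sweep-into-last-other A c' r col col≢) (sym (sweep-into-last-other A c r col col≢)))

lower : ∀ {m} → Mat (suc m) → Mat m
lower A i j = A (suc i) (suc j)

-- A unit corner with zeros below it splits off as a 1 ⊕ block (clear row 0 by column operations).
clear-first-row : ∀ {m} (A : Mat (suc m)) → A zero zero ≡ 1ℤ → (∀ i → A (suc i) zero ≡ 0ℤ) → A ∼ 1ℤ ⊕ lower A
clear-first-row A a₀₀ col = ∼-≈ʳ (sweep-from-0-∼ A (λ j → - A zero (suc j))) cleared
  where
  cancel : ∀ a → a + - a * 1ℤ ≡ 0ℤ
  cancel = solve-∀
  keep : ∀ a b → a + - b * 0ℤ ≡ a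
  keep = solve-∀
  cleared : sweep-from-0 A (λ j → - A zero (suc j)) ≈ 1ℤ ⊕ lower A
  cleared zero zero = a₀₀
  cleared zero (suc j) = trans (cong (λ w → A zero (suc j) + - A zero (suc j) * w) a₀₀) (cancel (A zero (suc j)))
  cleared (suc i) zero = col i
  cleared (suc i) (suc j) =
    trans (cong (λ w → A (suc i) (suc j) + - A zero (suc j) * w) (col i)) (keep (A (suc i) (suc j)) (A zero (suc j)))

clear-first-column : ∀ {m} (A : Mat (suc m)) → A zero zero ≡ 1ℤ → (∀ j → A zero (suc j) ≡ 0ℤ) → A ∼ 1ℤ ⊕ lower A
clear-first-column A a₀₀ row = ∼-≈ʳ (∼-transpose (clear-first-row (transpose A) a₀₀ row)) (⊕-transpose 1ℤ _)

sign-unit : ∀ x → Σ ℤ λ ε → (ε ≡ 1ℤ ⊎ ε ≡ -1ℤ) × ε * x ≡ + ∣ x ∣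
sign-unit (+ n) = 1ℤ , inj₁ refl , ℤP.*-identityˡ (+ n)
sign-unit (-[1+ n ]) = -1ℤ , inj₂ refl , ℤP.-1*i≡-i -[1+ n ]

scale-first-row : ∀ {m} (A : Mat (suc m)) ε → ε ≡ 1ℤ ⊎ ε ≡ -1ℤ →
  Σ (Mat (suc m)) λ A' → A ∼ A' × (∀ c → A' zero c ≡ ε * A zero c) × (∀ i c → A' (suc i) c ≡ A (suc i) c)
scale-first-row A ε (inj₁ refl) = A , ∼-refl , (λ c → sym (ℤP.*-identityˡ _)) , (λ i c → refl)
scale-first-row A ε (inj₂ refl) = negRow zero A , ∼-step (rowNeg A zero) ,
  (λ c → trans (neg-same zero A c) (sym (ℤP.-1*i≡-i (A zero c)))) , (λ i c → neg-other zero A (suc i) c (λ ()))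

split-isolated-corner : ∀ {m} (A : Mat (suc m)) → (∀ i → A (suc i) zero ≡ 0ℤ) → (∀ j → A zero (suc j) ≡ 0ℤ) →
  A ∼ (+ ∣ A zero zero ∣) ⊕ lower A
split-isolated-corner A col row with sign-unit (A zero zero)
... | ε , unit , εa≡∣a∣ with scale-first-row A ε unit
... | A' , A∼A' , row₀ , rows = ∼-≈ʳ A∼A' block
  where
  block : A' ≈ (+ ∣ A zero zero ∣) ⊕ lower A
  block zero zero = trans (row₀ zero) εa≡∣a∣
  block zero (suc j) = trans (row₀ (suc j)) (trans (cong (ε *_) (row j)) (ℤP.*-zeroʳ ε))
  block (suc i) zero = trans (rows i zero) (col i)
  block (suc i) (suc j) = rows i (suc j)

split-unit-corner : ∀ {m} (A : Mat (suc m)) → ∣ A zero zero ∣ ≡ 1 → (∀ i → A (suc i) zero ≡ 0ℤ) → A ∼ 1ℤ ⊕ lower A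
split-unit-corner A unit col with sign-unit (A zero zero)
... | ε , ε-unit , εa≡∣a∣ with scale-first-row A ε ε-unit
... | A' , A∼A' , row₀ , rows =
  ∼-trans A∼A' (∼-≈ʳ (clear-first-row A' (trans (row₀ zero) (trans εa≡∣a∣ (cong +_ unit)))
                                         (λ i → trans (rows i zero) (col i)))
                     (⊕-cong 1ℤ (λ i j → rows i (suc j))))

tr-zero-suc : ∀ {m} (r : Fin (suc m)) i → tr zero r (suc i) ≢ r
tr-zero-suc r i e with tr-injective zero r {suc i} {zero} (trans e (sym (tr-i zero r)))
... | ()

-- Deleting row r and column j (the remaining rows and columns permuted by transpositions with 0).
delete : ∀ {m} → Mat (suc m) → Fin (suc m) → Fin (suc m) → Mat m
delete N r j = lower (permute N zero r zero j)

split-unit : ∀ {m} (N : Mat (suc m)) r j → ∣ N r j ∣ ≡ 1 → (∀ i → i ≢ r → N i j ≡ 0ℤ) → N ∼ 1ℤ ⊕ delete N r j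
split-unit N r j unit z = ∼-trans (permute-∼ N zero r zero j)
  (split-unit-corner (permute N zero r zero j) (trans (cong ∣_∣ (cong₂ N (tr-i zero r) (tr-i zero j))) unit)
    (λ i → trans (cong (N (tr zero r (suc i))) (tr-i zero j)) (z _ (tr-zero-suc r i))))

split-isolated : ∀ {m} (N : Mat (suc m)) r j → (∀ i → i ≢ r → N i j ≡ 0ℤ) → (∀ k → k ≢ j → N r k ≡ 0ℤ) →
  N ∼ (+ ∣ N r j ∣) ⊕ delete N r j
split-isolated N r j col row = ∼-trans (permute-∼ N zero r zero j)
  (∼-≈ʳ (split-isolated-corner (permute N zero r zero j)
          (λ i → trans (cong (N (tr zero r (suc i))) (tr-i zero j)) (col _ (tr-zero-suc r i)))
          (λ k → trans (cong (λ x → N x (tr zero j (suc k))) (tr-i zero r)) (row _ (tr-zero-suc j k))))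
        (⊕-corner (delete N r j) (cong (λ x → + ∣ x ∣) (cong₂ N (tr-i zero r) (tr-i zero j)))))

DiagonalForm : ∀ {m} → Mat m → Set
DiagonalForm {m} N = Σ ℕ λ s → s ≤ m × N ∼ D s

via-unit-block : ∀ {m} {N : Mat (suc m)} {M : Mat m} → N ∼ 1ℤ ⊕ M → DiagonalForm M → DiagonalForm N
via-unit-block chain (s , s≤m , M∼D) = suc s , s≤s s≤m , ∼-trans chain (∼-≈ʳ (∼-⊕ 1ℤ M∼D) (⊕-D-1 s))

via-double-block : ∀ {m} {N : Mat (suc m)} {M : Mat m} → N ∼ (+ 2) ⊕ M → DiagonalForm M → DiagonalForm N
via-double-block chain (s , s≤m , M∼D) = s , ℕP.m≤n⇒m≤1+n s≤m , ∼-trans chain (∼-trans (∼-⊕ (+ 2) M∼D) (⊕-D-2 s s≤m))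

kernel-of-block : ∀ {m} {N : Mat (suc m)} {M : Mat m} k → N ∼ k ⊕ M → TrivialKernel N → TrivialKernel M
kernel-of-block {M = M} k chain tk = kernel-⊕ k M (kernel-≅ (∼-≅ chain) tk)

no-zero-column : ∀ {m} (N : Mat m) j → (∀ i → N i j ≡ 0ℤ) → TrivialKernel N → ⊥
no-zero-column {m} N j z tk with trans (sym (δ-same j)) (tk X NX≈O j j)
  where
  X : Mat m
  X k _ = δ k j
  NX≈O : N · X ≈ O
  NX≈O i _ = trans (Σ-single m _ j (λ k k≢j → trans (cong (N i k *_) (δ-other k j k≢j)) (ℤP.*-zeroʳ (N i k))))
                   (trans (cong (N i j *_) (δ-same j)) (trans (ℤP.*-identityʳ _) (z i)))
... | ()

colW : ∀ {m} → Mat m → Fin m → ℕ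
colW N j = Wt (λ i → N i j)

column-total : ∀ {m} (N : Mat m) → ΣN m (colW N) ≡ ΣN m (λ i → Wt (N i))
column-total {m} N = sym (ΣN-swap m m (λ i j → ∣ N i j ∣))

all-heavy : ∀ n (f : Fin n → ℕ) → (∀ j → ¬ f j ≤ 2) → n *ℕ 3 ≤ ΣN n f
all-heavy n f heavy = subst (_≤ ΣN n f) (ΣN-const n 3) (ΣN-mono n (λ j → ℕP.≰⇒> (heavy j)))

SmallRows : ∀ {m} → Mat m → Set
SmallRows N = ∀ i → Wt (N i) ≤ 2

-- Pigeonhole: if all rows weigh at most 2, some column weighs at most 2.
light-column : ∀ {m} (N : Mat (suc m)) → SmallRows N → Σ (Fin (suc m)) λ j → colW N j ≤ 2
light-column {m} N small with FinP.any? (λ j → colW N j ≤? 2)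
... | yes found = found
... | no none = ⊥-elim (ℕP.<-irrefl refl (ℕP.*-cancelˡ-≤ (suc m) counting))
  where
  counting : suc m *ℕ 3 ≤ suc m *ℕ 2
  counting = ℕP.≤-trans (all-heavy (suc m) (colW N) (λ j light → none (j , light)))
    (ℕP.≤-trans (ℕP.≤-reflexive (column-total N)) (subst (ΣN (suc m) (λ i → Wt (N i)) ≤_) (ΣN-const (suc m) 2) (ΣN-mono (suc m) small)))

Wt-tail : ∀ {n} (v : Fin (suc n) → ℤ) → Wt (λ k → v (suc k)) ≤ Wt v
Wt-tail v = ℕP.m≤n+m _ ∣ v zero ∣

delete-small : ∀ {m} (N : Mat (suc m)) r j → SmallRows N → SmallRows (delete N r j)
delete-small N r j small i = ℕP.≤-trans (Wt-tail (λ k → N x (tr zero j k)))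
  (subst (_≤ 2) (sym (Wt-tr (N x) zero j)) (small x))
  where x = tr zero r (suc i)

cancel-weight : ∀ {n} (v w : Fin (suc n) → ℤ) b c → ∣ c ∣ ≡ 1 → v b + c * w b ≡ 0ℤ → ∣ v b ∣ ≡ 1 → ∣ w b ∣ ≡ 1 →
  Wt (λ i → v i + c * w i) +ℕ 2 ≤ Wt v +ℕ Wt w
cancel-weight {n} v w b c ∣c∣≡1 cancels ∣vb∣≡1 ∣wb∣≡1 =
  subst₂ _≤_ (sym left) (trans (regroup Rv Rw) (sym (cong₂ _+ℕ_ (split v ∣vb∣≡1) (split w ∣wb∣≡1))))
    (ℕP.+-monoˡ-≤ 2 rest-bound)
  where
  u : Fin (suc n) → ℤ
  u i = v i + c * w i
  rest : (Fin (suc n) → ℤ) → ℕ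
  rest x = Wt (λ i → x (punchIn b i))
  Rv = rest v
  Rw = rest w
  regroup : ∀ a b → a +ℕ b +ℕ 2 ≡ suc a +ℕ suc b
  regroup = ℕSolver.solve-∀
  split : ∀ x → ∣ x b ∣ ≡ 1 → Wt x ≡ suc (rest x)
  split x e = trans (Wt-punch x b) (cong (_+ℕ rest x) e)
  left : Wt u +ℕ 2 ≡ rest u +ℕ 2
  left = cong (_+ℕ 2) (trans (Wt-punch u b) (cong (_+ℕ rest u) (cong ∣_∣ cancels)))
  -- entrywise triangle inequality away from b, using ∣ c ∣ = 1
  rest-bound : rest u ≤ Rv +ℕ Rw
  rest-bound = subst (rest u ≤_) (ΣN-+ n (λ i → ∣ v (punchIn b i) ∣) (λ i → ∣ w (punchIn b i) ∣))
    (ΣN-mono n (λ i → ℕP.≤-trans (ℤP.∣i+j∣≤∣i∣+∣j∣ (v (punchIn b i)) (c * w (punchIn b i)))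
      (ℕP.+-monoʳ-≤ ∣ v (punchIn b i) ∣
        (ℕP.≤-reflexive (trans (ℤP.abs-* c (w (punchIn b i))) (trans (cong (_*ℕ ∣ w (punchIn b i) ∣) ∣c∣≡1) (ℕP.*-identityˡ _)))))))

Linear : ∀ {d e} → ((Fin d → ℤ) → (Fin e → ℤ)) → Set
Linear {d} φ = ∀ (v w : Fin d → ℤ) c k → φ (λ i → v i + c * w i) k ≡ φ v k + c * φ w k

Extensional : ∀ {d e} → ((Fin d → ℤ) → (Fin e → ℤ)) → Set
Extensional {d} φ = ∀ {v w : Fin d → ℤ} → (∀ i → v i ≡ w i) → ∀ k → φ v k ≡ φ w k

BoundedBy : ∀ {d e} → ((Fin d → ℤ) → (Fin e → ℤ)) → Mat d → Set
BoundedBy φ N = ∀ i → Wt (φ (N i)) ≤ 2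

-- Two unit entries in column j (seen by φ at index b): adding ±(row r₁) to row r₂ kills the second one
-- and keeps the invariant.
cancel-second-unit : ∀ {d e} (φ : (Fin d → ℤ) → (Fin (suc e) → ℤ)) → Extensional φ → Linear φ →
  (N : Mat d) → BoundedBy φ N → ∀ j b → (∀ i → φ (N i) b ≡ N i j) →
  ∀ r₁ r₂ → r₁ ≢ r₂ → ∣ N r₁ j ∣ ≡ 1 → ∣ N r₂ j ∣ ≡ 1 →
  Σ (Mat d) λ N' → N ∼ N' × BoundedBy φ N' × N' r₂ j ≡ 0ℤ × (∀ i k → i ≢ r₂ → N' i k ≡ N i k)
cancel-second-unit φ φ-ext φ-lin N bounded j b seen r₁ r₂ r₁≢r₂ unit₁ unit₂ =
  N' , ∼-step (rowAdd N r₂ r₁ c (r₁≢r₂ ∘ sym)) , bounded' , trans (add-same r₂ r₁ c N j) cancels ,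
  (λ i k i≢r₂ → add-other r₂ r₁ c N i k i≢r₂)
  where
  c = - (N r₂ j * N r₁ j)
  N' = addRow r₂ r₁ c N
  unit-c : ∣ c ∣ ≡ 1
  unit-c = trans (ℤP.∣-i∣≡∣i∣ (N r₂ j * N r₁ j)) (trans (ℤP.abs-* (N r₂ j) (N r₁ j)) (cong₂ _*ℕ_ unit₂ unit₁))
  cancels : N r₂ j + c * N r₁ j ≡ 0ℤ
  cancels = trans (regroup (N r₂ j) (N r₁ j))
    (trans (cong (λ w → N r₂ j + - (N r₂ j * w)) (unit-square (N r₁ j) unit₁))
           (trans (cong (λ w → N r₂ j + - w) (ℤP.*-identityʳ (N r₂ j))) (ℤP.+-inverseʳ (N r₂ j))))
    where
    regroup : ∀ a b → a + - (a * b) * b ≡ a + - (a * (b * b))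
    regroup = solve-∀
  image : ∀ k → φ (N' r₂) k ≡ φ (N r₂) k + c * φ (N r₁) k
  image k = trans (φ-ext (add-same r₂ r₁ c N) k) (φ-lin (N r₂) (N r₁) c k)
  bounded' : BoundedBy φ N'
  bounded' i = by-cases (i ≟ r₂)
    where
    by-cases : Dec (i ≡ r₂) → Wt (φ (N' i)) ≤ 2
    by-cases (yes refl) = ℕP.+-cancelʳ-≤ 2 (Wt (φ (N' i))) 2 (ℕP.≤-trans
      (subst (λ z → z +ℕ 2 ≤ Wt (φ (N i)) +ℕ Wt (φ (N r₁))) (sym (Wt-cong image))
             (cancel-weight (φ (N i)) (φ (N r₁)) b c unit-c
                (trans (cong₂ (λ x y → x + c * y) (seen i) (seen r₁)) cancels)
                (trans (cong ∣_∣ (seen i)) unit₂) (trans (cong ∣_∣ (seen r₁)) unit₁)))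
      (ℕP.+-mono-≤ (bounded i) (bounded r₁)))
    by-cases (no i≢r₂) = subst (_≤ 2) (sym (Wt-cong (φ-ext (λ k → add-other r₂ r₁ c N i k i≢r₂)))) (bounded i)

via-chain : ∀ {m} {N N' : Mat m} → N ∼ N' → DiagonalForm N' → DiagonalForm N
via-chain chain (s , s≤m , N'∼D) = s , s≤m , ∼-trans chain N'∼D

lone-unit : ∀ {d} (N N' : Mat d) j r₁ r₂ → r₁ ≢ r₂ → (∀ i → i ≢ r₁ → i ≢ r₂ → N i j ≡ 0ℤ) →
  N' r₂ j ≡ 0ℤ → (∀ i k → i ≢ r₂ → N' i k ≡ N i k) → ∀ i → i ≢ r₁ → N' i j ≡ 0ℤ
lone-unit N N' j r₁ r₂ r₁≢r₂ z killed kept i i≢r₁ with i ≟ r₂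
... | yes refl = killed
... | no i≢r₂ = trans (kept i j i≢r₂) (z i i≢r₁ i≢r₂)

SmallRowsTheorem : ℕ → Set
SmallRowsTheorem m = ∀ (M : Mat m) → SmallRows M → TrivialKernel M → DiagonalForm M

split-off-unit : ∀ {m} → SmallRowsTheorem m → ∀ (N : Mat (suc m)) → SmallRows N → TrivialKernel N →
  ∀ r j → ∣ N r j ∣ ≡ 1 → (∀ i → i ≢ r → N i j ≡ 0ℤ) → DiagonalForm N
split-off-unit IH N small tk r j unit z =
  via-unit-block chain (IH (delete N r j) (delete-small N r j small) (kernel-of-block 1ℤ chain tk))
  where chain = split-unit N r j unit z

small-rows-step : ∀ {m} → SmallRowsTheorem m → SmallRowsTheorem (suc m)
small-rows-step {m} IH N small tk with light-column N small
... | j , light with shape (suc m) (λ i → N i j) light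
... | null z = ⊥-elim (no-zero-column N j z tk)
... | one-unit r unit z = split-off-unit IH N small tk r j unit z
... | one-double r double z = via-double-block chain
  (IH (delete N r j) (delete-small N r j small) (kernel-of-block (+ 2) chain tk))
  where
  chain : N ∼ (+ 2) ⊕ delete N r j
  chain = ∼-≈ʳ (split-isolated N r j z (concentrated (N r) j double (small r)))
               (⊕-corner (delete N r j) (cong +_ double))
... | two-units r₁ r₂ r₁≢r₂ unit₁ unit₂ z
  with cancel-second-unit (λ v → v) (λ e → e) (λ v w c k → refl) N small j j (λ i → refl) r₁ r₂ r₁≢r₂ unit₁ unit₂
... | N' , N∼N' , small' , killed , kept =
  via-chain N∼N' (split-off-unit IH N' small' (kernel-≅ (∼-≅ N∼N') tk) r₁ j
                   (trans (cong ∣_∣ (kept r₁ j r₁≢r₂)) unit₁) (lone-unit N N' j r₁ r₂ r₁≢r₂ z killed kept))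

small-rows-theorem : ∀ m → SmallRowsTheorem m
small-rows-theorem zero N _ _ = 0 , z≤n , done (λ ())
small-rows-theorem (suc m) = small-rows-step (small-rows-theorem m)

-- For a row (a, 1) of the theorem, ψ v is a nonnegative vector of total 2,
-- so the hypotheses say exactly that every row of A has ψ-weight at most 2.
ψ : ∀ {n} → (Fin (suc n) → ℤ) → Fin (suc n) → ℤ
ψ {n} v zero = + 2 * v (fromℕ n) + - Σ[ n ] (λ j → v (inject₁ j))
ψ v (suc j) = v (inject₁ j)

ψ-ext : ∀ {n} → Extensional (ψ {n})
ψ-ext {n} e zero = cong₂ (λ x y → + 2 * x + - y) (e (fromℕ n)) (Σ-cong n (λ j → e (inject₁ j)))
ψ-ext e (suc j) = e (inject₁ j)

ψ-linear : ∀ {n} → Linear (ψ {n})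
ψ-linear {n} v w c zero =
  trans (cong (λ z → + 2 * (v (fromℕ n) + c * w (fromℕ n)) + - z)
              (trans (Σ-+ n (λ j → v (inject₁ j)) (λ j → c * w (inject₁ j)))
                     (cong (_+_ (Σ[ n ] (λ j → v (inject₁ j)))) (Σ-*ˡ n c (λ j → w (inject₁ j))))))
        (distrib c (v (fromℕ n)) (w (fromℕ n)) _ _)
  where
  distrib : ∀ c a b x y → + 2 * (a + c * b) + - (x + c * y) ≡ + 2 * a + - x + c * (+ 2 * b + - y)
  distrib = solve-∀
ψ-linear v w c (suc j) = refl

ψ-permute : ∀ {n} (v : Fin (suc n) → ℤ) (a b : Fin n) k →
  ψ (λ c → v (tr (inject₁ a) (inject₁ b) c)) k ≡ ψ v (tr (suc a) (suc b) k)
ψ-permute {n} v a b zero =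
  trans (cong₂ (λ x y → + 2 * x + - y) (cong v (tr-fromℕ a b))
               (trans (Σ-cong n (λ j → cong v (tr-inject₁ a b j))) (Σ-tr n (λ j → v (inject₁ j)) a b)))
        (cong (ψ v) (sym (tr-zero a b)))
ψ-permute v a b (suc j) = trans (cong v (tr-inject₁ a b j)) (cong (ψ v) (sym (tr-suc a b j)))

Wt-ψ-permute : ∀ {n} (v : Fin (suc n) → ℤ) (a b : Fin n) → Wt (ψ (λ c → v (tr (inject₁ a) (inject₁ b) c))) ≡ Wt (ψ v)
Wt-ψ-permute v a b = trans (Wt-cong (ψ-permute v a b)) (Wt-tr (ψ v) (suc a) (suc b))

ψ-tail : ∀ {n} (v : Fin (suc (suc n)) → ℤ) → v zero ≡ 0ℤ → ∀ k → ψ (λ c → v (suc c)) k ≡ ψ v (punchIn (suc zero) k)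
ψ-tail {n} v z zero = cong (λ w → + 2 * v (fromℕ (suc n)) + - w)
  (sym (trans (cong (_+ Σ[ n ] (λ j → v (suc (inject₁ j)))) z) (ℤP.+-identityˡ _)))
ψ-tail v z (suc j) = refl

Wt-ψ-tail : ∀ {n} (v : Fin (suc (suc n)) → ℤ) → v zero ≡ 0ℤ → Wt (ψ (λ c → v (suc c))) ≡ Wt (ψ v)
Wt-ψ-tail v z = trans (Wt-cong (ψ-tail v z))
  (sym (trans (Wt-punch (ψ v) (suc zero)) (cong (_+ℕ Wt (λ k → ψ v (punchIn (suc zero) k))) (cong ∣_∣ z))))

delete-bounded : ∀ {n} (N : Mat (suc (suc n))) r b → (∀ i → i ≢ r → N i (inject₁ b) ≡ 0ℤ) →
  BoundedBy ψ N → BoundedBy ψ (delete N r (inject₁ b))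
delete-bounded N r b z bounded i = subst (_≤ 2) (sym weight) (bounded x)
  where
  x = tr zero r (suc i)
  weight : Wt (ψ (delete N r (inject₁ b) i)) ≡ Wt (ψ (N x))
  weight = trans (Wt-ψ-tail (λ c → N x (tr zero (inject₁ b) c))
                            (trans (cong (N x) (tr-i zero (inject₁ b))) (z x (tr-zero-suc r i))))
                 (Wt-ψ-permute (N x) zero b)

-- If the first entry of every ψ-row vanishes, A kills the vector (1, …, 1, −2).
no-trivial-kernel : ∀ n (A : Mat (suc n)) → (∀ i → ψ (A i) zero ≡ 0ℤ) → TrivialKernel A → ⊥
no-trivial-kernel n A z tk with trans (sym x-last) (tk X AX≈O (fromℕ n) zero)
  where
  x : Fin (suc n) → ℤ
  x c with c ≟ fromℕ n
  ... | yes _ = - + 2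
  ... | no _ = 1ℤ
  x-last : x (fromℕ n) ≡ - + 2
  x-last with fromℕ n ≟ fromℕ n
  ... | yes _ = refl
  ... | no ≢ = ⊥-elim (≢ refl)
  x-first : ∀ j → x (inject₁ j) ≡ 1ℤ
  x-first j with inject₁ j ≟ fromℕ n
  ... | yes e = ⊥-elim (FinP.fromℕ≢inject₁ (sym e))
  ... | no _ = refl
  X : Mat (suc n)
  X k _ = x k
  rearrange : ∀ s t → s + t * - + 2 ≡ - (+ 2 * t + - s)
  rearrange = solve-∀
  AX≈O : A · X ≈ O
  AX≈O i _ = trans (Σ-last n (λ c → A i c * x c))
    (trans (cong₂ _+_ (Σ-cong n (λ j → trans (cong (A i (inject₁ j) *_) (x-first j)) (ℤP.*-identityʳ _)))
                      (cong (A i (fromℕ n) *_) x-last))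
    (trans (rearrange _ (A i (fromℕ n))) (cong -_ (z i))))
... | ()

loop-row : ∀ {n} (v : Fin (suc n) → ℤ) b → Wt (ψ v) ≤ 2 → ∣ v (inject₁ b) ∣ ≡ 2 →
  (∀ j → j ≢ b → v (inject₁ j) ≡ 0ℤ) × v (inject₁ b) ≡ + 2 * v (fromℕ n) × ∣ v (fromℕ n) ∣ ≡ 1
loop-row {n} v b bounded double = others , doubled , unit
  where
  quiet : ∀ k → k ≢ suc b → ψ v k ≡ 0ℤ
  quiet = concentrated (ψ v) (suc b) double bounded
  others : ∀ j → j ≢ b → v (inject₁ j) ≡ 0ℤ
  others j j≢b = quiet (suc j) (j≢b ∘ FinP.suc-injective)
  doubled : v (inject₁ b) ≡ + 2 * v (fromℕ n)
  doubled = sym (trans (ℤP.i-j≡0⇒i≡j _ _ (quiet zero (λ ()))) (Σ-single n _ b others))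
  unit : ∣ v (fromℕ n) ∣ ≡ 1
  unit = ℕP.*-cancelˡ-≡ ∣ v (fromℕ n) ∣ 1 2 (trans (sym (ℤP.abs-* (+ 2) (v (fromℕ n)))) (trans (cong ∣_∣ (sym doubled)) double))

record LoopCorner {n} (A : Mat (suc (suc n))) : Set where
  field
    corner : A zero zero ≡ + 2
    last : A zero (fromℕ (suc n)) ≡ 1ℤ
    middle : ∀ c → c ≢ zero → c ≢ fromℕ (suc n) → A zero c ≡ 0ℤ
    below : ∀ i → A (suc i) zero ≡ 0ℤ

loop-normalise : ∀ {n} (A : Mat (suc (suc n))) r b → BoundedBy ψ A → ∣ A r (inject₁ b) ∣ ≡ 2 →
  (∀ i → i ≢ r → A i (inject₁ b) ≡ 0ℤ) →
  Σ (Mat (suc (suc n))) λ A₂ → A ∼ A₂ × LoopCorner A₂ × (∀ i c → A₂ (suc i) c ≡ A (tr zero r (suc i)) (tr zero (inject₁ b) c))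
loop-normalise {n} A r b bounded double z with loop-row (A r) b (bounded r) double
... | others , doubled , unit with scale-first-row P t (abs≡1 t unit)
  where
  t = A r (fromℕ (suc n))
  P = permute A zero r zero (inject₁ b)
... | A₂ , P∼A₂ , row₀ , rows = A₂ , ∼-trans (permute-∼ A zero r zero (inject₁ b)) P∼A₂ , loop-shape , rows
  where
  t = A r (fromℕ (suc n))
  σ = tr zero (inject₁ b)
  top : ∀ c → A₂ zero c ≡ t * A r (σ c)
  top c = trans (row₀ c) (cong (λ x → t * A x (σ c)) (tr-i zero r))
  tt : t * t ≡ 1ℤ
  tt = unit-square t unit
  twice : ∀ t → t * (+ 2 * t) ≡ + 2 * (t * t)
  twice = solve-∀
  loop-shape : LoopCorner A₂
  loop-shape = record
    { corner = trans (top zero) (trans (cong (λ x → t * A r x) (tr-i zero (inject₁ b)))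
                 (trans (cong (t *_) doubled) (trans (twice t) (cong (+ 2 *_) tt))))
    ; last = trans (top (fromℕ (suc n))) (trans (cong (λ x → t * A r x) (tr-fromℕ zero b)) tt)
    ; middle = middle
    ; below = λ i → trans (rows i zero) (trans (cong (A (tr zero r (suc i))) (tr-i zero (inject₁ b))) (z _ (tr-zero-suc r i)))
    }
    where
    middle : ∀ c → c ≢ zero → c ≢ fromℕ (suc n) → A₂ zero c ≡ 0ℤ
    middle c c≢0 c≢L with view c
    ... | ‵fromℕ = ⊥-elim (c≢L refl)
    ... | ‵inject₁ j = trans (top (inject₁ j))
      (trans (cong (λ x → t * A r x) (tr-inject₁ zero b j))
             (trans (cong (t *_) (others (tr zero b j) moved)) (ℤP.*-zeroʳ t)))
      where
      moved : tr zero b j ≢ b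
      moved e = c≢0 (cong inject₁ (tr-injective zero b (trans e (sym (tr-i zero b)))))

-- A loop corner splits off as a 1: subtract twice the last column from column 0, then swap the two.
loop-split : ∀ {n} (A₂ : Mat (suc (suc n))) → LoopCorner A₂ →
  Σ (Mat (suc n)) λ M → A₂ ∼ 1ℤ ⊕ M × (∀ i j → M i (inject₁ j) ≡ A₂ (suc i) (suc (inject₁ j)))
                                    × (∀ i → M i (fromℕ n) ≡ - + 2 * A₂ (suc i) (fromℕ (suc n)))
loop-split {n} A₂ loop = lower A₄ , chain , first , final
  where
  open LoopCorner loop
  L = fromℕ (suc n)
  A₃ = transpose (addRow zero L (- + 2) (transpose A₂))
  A₃-first : ∀ x → A₃ x zero ≡ A₂ x zero + - + 2 * A₂ x L
  A₃-first x = add-same zero L (- + 2) (transpose A₂) x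
  A₃-other : ∀ x c → c ≢ zero → A₃ x c ≡ A₂ x c
  A₃-other x c c≢0 = add-other zero L (- + 2) (transpose A₂) c x c≢0
  A₄ = transpose (swapRows zero L (transpose A₃))
  A₄-entry : ∀ x c → A₄ x c ≡ A₃ x (tr zero L c)
  A₄-entry x c = swap-entry zero L (transpose A₃) c x
  top-left : A₄ zero zero ≡ 1ℤ
  top-left = trans (A₄-entry zero zero) (trans (cong (A₃ zero) (tr-i zero L)) (trans (A₃-other zero L (λ ())) last))
  top-rest : ∀ k → A₄ zero (suc k) ≡ 0ℤ
  top-rest k = trans (A₄-entry zero (suc k)) (by-cases (suc k ≟ L))
    where
    by-cases : Dec (suc k ≡ L) → A₃ zero (tr zero L (suc k)) ≡ 0ℤ
    by-cases (yes refl) = trans (cong (A₃ zero) (tr-j zero L))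
      (trans (A₃-first zero) (cong₂ (λ x y → x + - + 2 * y) corner last))
    by-cases (no k≢) = trans (cong (A₃ zero) (tr-other zero L (suc k) (λ ()) k≢))
      (trans (A₃-other zero (suc k) (λ ())) (middle (suc k) (λ ()) k≢))
  chain : A₂ ∼ 1ℤ ⊕ lower A₄
  chain = step (colAdd A₂ zero L (- + 2) (λ ())) (step (colSwap A₃ zero L) (clear-first-column A₄ top-left top-rest))
  first : ∀ i j → lower A₄ i (inject₁ j) ≡ A₂ (suc i) (suc (inject₁ j))
  first i j = trans (A₄-entry (suc i) (suc (inject₁ j)))
    (trans (cong (A₃ (suc i)) (tr-other zero L (suc (inject₁ j)) (λ ()) (FinP.fromℕ≢inject₁ ∘ sym ∘ FinP.suc-injective)))
           (A₃-other (suc i) (suc (inject₁ j)) (λ ())))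
  final : ∀ i → lower A₄ i (fromℕ n) ≡ - + 2 * A₂ (suc i) L
  final i = trans (A₄-entry (suc i) L) (trans (cong (A₃ (suc i)) (tr-j zero L))
    (trans (A₃-first (suc i)) (trans (cong (_+ - + 2 * A₂ (suc i) L) (below i)) (ℤP.+-identityˡ _))))

fold-last : ∀ {n} (M : Mat (suc n)) → Σ (Mat (suc n)) λ M' → M ∼ M' ×
  (∀ i j → M' i (inject₁ j) ≡ M i (inject₁ j)) × (∀ i → M' i (fromℕ n) ≡ - (M i (fromℕ n) + Σ[ n ] (λ j → M i (inject₁ j))))
fold-last {n} M = M' , ∼-trans (sweep-into-last-∼ M (λ _ → 1ℤ)) (∼-step (colNeg S (fromℕ n))) , first , final
  where
  S = sweep-into-last M (λ _ → 1ℤ)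
  M' = transpose (negRow (fromℕ n) (transpose S))
  first : ∀ i j → M' i (inject₁ j) ≡ M i (inject₁ j)
  first i j = trans (neg-other (fromℕ n) (transpose S) (inject₁ j) i (FinP.fromℕ≢inject₁ ∘ sym))
                    (sweep-into-last-other M _ i (inject₁ j) (FinP.fromℕ≢inject₁ ∘ sym))
  final : ∀ i → M' i (fromℕ n) ≡ - (M i (fromℕ n) + Σ[ n ] (λ j → M i (inject₁ j)))
  final i = trans (neg-same (fromℕ n) (transpose S) i)
    (cong -_ (trans (sweep-into-last-last M _ i) (cong (_+_ (M i (fromℕ n))) (Σ-cong n (λ j → ℤP.*-identityˡ _)))))

folded-weight : ∀ {n} (w : Fin (suc (suc n)) → ℤ) (u : Fin (suc n) → ℤ) → w zero ≡ 0ℤ →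
  (∀ j → u (inject₁ j) ≡ w (suc (inject₁ j))) →
  u (fromℕ n) ≡ - (- + 2 * w (fromℕ (suc n)) + Σ[ n ] (λ j → w (suc (inject₁ j)))) → Wt u ≡ Wt (ψ w)
folded-weight {n} w u w₀≡0 first final =
  trans (Wt-last u) (trans (cong₂ _+ℕ_ (Wt-cong first) (cong ∣_∣ (trans final rearranged)))
        (trans (ℕP.+-comm W _) (cong (∣ ψ w zero ∣ +ℕ_) (cong (_+ℕ W) (sym (cong ∣_∣ w₀≡0))))))
  where
  S = Σ[ n ] (λ j → w (suc (inject₁ j)))
  W = Wt (λ j → w (suc (inject₁ j)))
  identity : ∀ a s → - (- + 2 * a + s) ≡ + 2 * a + - (0ℤ + s)
  identity = solve-∀
  rearranged : - (- + 2 * w (fromℕ (suc n)) + S) ≡ ψ w zero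
  rearranged = trans (identity (w (fromℕ (suc n))) S) (cong (λ x → + 2 * w (fromℕ (suc n)) + - (x + S)) (sym w₀≡0))

-- A column of the first n with a single ±2: split off the loop row as a 1; what remains has small rows.
loop-case : ∀ {n} (A : Mat (suc (suc n))) → BoundedBy ψ A → TrivialKernel A →
  ∀ r b → ∣ A r (inject₁ b) ∣ ≡ 2 → (∀ i → i ≢ r → A i (inject₁ b) ≡ 0ℤ) → DiagonalForm A
loop-case {n} A bounded tk r b double z with loop-normalise A r b bounded double z
... | A₂ , A∼A₂ , loop , rows with loop-split A₂ loop
... | M , A₂∼1⊕M , M-first , M-final with fold-last M
... | M' , M∼M' , M'-first , M'-final =
  via-unit-block chain (small-rows-theorem (suc n) M' small (kernel-of-block 1ℤ chain tk))
  where
  chain : A ∼ 1ℤ ⊕ M'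
  chain = ∼-trans A∼A₂ (∼-trans A₂∼1⊕M (∼-⊕ 1ℤ M∼M'))
  small : SmallRows M'
  small i = subst (_≤ 2) (sym weight) (bounded x)
    where
    x = tr zero r (suc i)
    final : M' i (fromℕ n) ≡ - (- + 2 * A₂ (suc i) (fromℕ (suc n)) + Σ[ n ] (λ j → A₂ (suc i) (suc (inject₁ j))))
    final = trans (M'-final i) (cong₂ (λ a s → - (a + s)) (M-final i) (Σ-cong n (M-first i)))
    weight : Wt (M' i) ≡ Wt (ψ (A x))
    weight = trans (folded-weight (A₂ (suc i)) (M' i) (LoopCorner.below loop i)
                                  (λ j → trans (M'-first i j) (M-first i j)) final)
             (trans (Wt-cong (ψ-ext (rows i))) (Wt-ψ-permute (A x) zero b))

BoundedTheorem : ℕ → Set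
BoundedTheorem n = ∀ (A : Mat (suc n)) → BoundedBy ψ A → TrivialKernel A → DiagonalForm A

-- For 1 × 1 matrices the ψ-bound 2∣a∣ ≤ 2 says the single row is small.
bounded-base : BoundedTheorem 0
bounded-base A bounded tk = small-rows-theorem 1 A small tk
  where
  small : SmallRows A
  small zero = ℕP.≤-trans (ℕP.*-cancelˡ-≤ {n = 1} 2 (subst (_≤ 2) weight (bounded zero))) (s≤s z≤n)
    where
    weight : Wt (ψ (A zero)) ≡ 2 *ℕ (∣ A zero zero ∣ +ℕ 0)
    weight = trans (ℕP.+-identityʳ _) (trans (cong ∣_∣ (ℤP.+-identityʳ (+ 2 * A zero zero)))
                   (trans (ℤP.abs-* (+ 2) (A zero zero)) (cong (2 *ℕ_) (sym (ℕP.+-identityʳ ∣ A zero zero ∣)))))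

bounded-split-off-unit : ∀ {n} → BoundedTheorem n → ∀ (A : Mat (suc (suc n))) → BoundedBy ψ A → TrivialKernel A →
  ∀ r b → ∣ A r (inject₁ b) ∣ ≡ 1 → (∀ i → i ≢ r → A i (inject₁ b) ≡ 0ℤ) → DiagonalForm A
bounded-split-off-unit IH A bounded tk r b unit z = via-unit-block chain
  (IH (delete A r (inject₁ b)) (delete-bounded A r b z bounded) (kernel-of-block 1ℤ chain tk))
  where chain = split-unit A r (inject₁ b) unit z

light-case : ∀ {n} → BoundedTheorem n → ∀ (A : Mat (suc (suc n))) → BoundedBy ψ A → TrivialKernel A →
  ∀ b → colW A (inject₁ b) ≤ 2 → DiagonalForm A
light-case {n} IH A bounded tk b light with shape (suc (suc n)) (λ i → A i (inject₁ b)) light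
... | null z = ⊥-elim (no-zero-column A (inject₁ b) z tk)
... | one-unit r unit z = bounded-split-off-unit IH A bounded tk r b unit z
... | one-double r double z = loop-case A bounded tk r b double z
... | two-units r₁ r₂ r₁≢r₂ unit₁ unit₂ z
  with cancel-second-unit ψ ψ-ext ψ-linear A bounded (inject₁ b) (suc b) (λ i → refl) r₁ r₂ r₁≢r₂ unit₁ unit₂
... | A' , A∼A' , bounded' , killed , kept =
  via-chain A∼A' (bounded-split-off-unit IH A' bounded' (kernel-≅ (∼-≅ A∼A') tk) r₁ b
                   (trans (cong ∣_∣ (kept r₁ (inject₁ b) r₁≢r₂)) unit₁)
                   (lone-unit A A' (inject₁ b) r₁ r₂ r₁≢r₂ z killed kept))

-- 2 × 2 matrices whose ψ-rows have first entries of absolute value at most 1: subtracting twice the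
-- last column from the first one makes the rows small.
two-by-two-case : ∀ (A : Mat 2) → BoundedBy ψ A → TrivialKernel A → (∀ i → ∣ ψ (A i) zero ∣ ≤ 1) → DiagonalForm A
two-by-two-case A bounded tk first≤1 = via-chain (∼-step step₁)
  (small-rows-theorem 2 A' small (kernel-≅ (∼-≅ (∼-step step₁)) tk))
  where
  step₁ = colAdd A zero (suc zero) (- + 2) (λ ())
  A' = transpose (addRow zero (suc zero) (- + 2) (transpose A))
  small : SmallRows A'
  small r = subst (_≤ 2) (sym (cong (_+ℕ (∣ t ∣ +ℕ 0)) (trans (cong ∣_∣ new-first) (ℤP.∣-i∣≡∣i∣ p))))
                  (ℕP.+-mono-≤ (first≤1 r) (ℕP.+-monoˡ-≤ 0 t≤1))
    where
    a = A r zero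
    t = A r (suc zero)
    p = ψ (A r) zero
    new-first : a + - + 2 * t ≡ - p
    new-first = rearrange a t
      where
      rearrange : ∀ a t → a + - + 2 * t ≡ - (+ 2 * t + - (a + 0ℤ))
      rearrange = solve-∀
    -- ∣ 2t ∣ = ∣ p + a ∣ ≤ ∣ p ∣ + ∣ a ∣ = Wt (ψ (A r)) ≤ 2
    t≤1 : ∣ t ∣ ≤ 1
    t≤1 = ℕP.*-cancelˡ-≤ 2 (subst (_≤ 2) (ℤP.abs-* (+ 2) t) (ℕP.≤-trans triangle (subst (_≤ 2) weight (bounded r))))
      where
      split : + 2 * t ≡ p + a
      split = rearrange a t
        where
        rearrange : ∀ a t → + 2 * t ≡ (+ 2 * t + - (a + 0ℤ)) + a
        rearrange = solve-∀
      triangle : ∣ + 2 * t ∣ ≤ ∣ p ∣ +ℕ ∣ a ∣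
      triangle = subst (λ z → ∣ z ∣ ≤ ∣ p ∣ +ℕ ∣ a ∣) (sym split) (ℤP.∣i+j∣≤∣i∣+∣j∣ p a)
      weight : Wt (ψ (A r)) ≡ ∣ p ∣ +ℕ ∣ a ∣
      weight = cong (∣ p ∣ +ℕ_) (ℕP.+-identityʳ ∣ a ∣)

-- If all of the first columns weigh at least 3, counting the ψ-weight leaves at most 1 for column 0 of the
-- ψ-rows and forces the size to be 2.
heavy-counting : ∀ n g → g +ℕ suc n *ℕ 3 ≤ suc (suc n) *ℕ 2 → g +ℕ n ≤ 1
heavy-counting n g le = ℕP.+-cancelˡ-≤ (2 *ℕ n +ℕ 3) _ _ (subst₂ _≤_ (lhs n g) (rhs n) le)
  where
  lhs : ∀ n g → g +ℕ suc n *ℕ 3 ≡ 2 *ℕ n +ℕ 3 +ℕ (g +ℕ n)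
  lhs = ℕSolver.solve-∀
  rhs : ∀ n → suc (suc n) *ℕ 2 ≡ 2 *ℕ n +ℕ 3 +ℕ 1
  rhs = ℕSolver.solve-∀

heavy-case : ∀ n (A : Mat (suc (suc n))) → BoundedBy ψ A → TrivialKernel A →
  (∀ b → ¬ colW A (inject₁ b) ≤ 2) → DiagonalForm A
heavy-case n A bounded tk heavy = by-cases n A bounded tk (heavy-counting n g counting) (g ℕP.≟ 0)
  where
  Ψ : Mat (suc (suc n))
  Ψ i = ψ (A i)
  g = colW Ψ zero
  counting : g +ℕ suc n *ℕ 3 ≤ suc (suc n) *ℕ 2
  counting = ℕP.≤-trans (ℕP.+-monoʳ-≤ g (all-heavy (suc n) (λ b → colW Ψ (suc b)) heavy))
    (ℕP.≤-trans (ℕP.≤-reflexive (column-total Ψ))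
                (subst (ΣN (suc (suc n)) (λ i → Wt (Ψ i)) ≤_) (ΣN-const (suc (suc n)) 2) (ΣN-mono (suc (suc n)) bounded)))
  by-cases : ∀ n (A : Mat (suc (suc n))) → BoundedBy ψ A → TrivialKernel A →
    colW (λ i → ψ (A i)) zero +ℕ n ≤ 1 → Dec (colW (λ i → ψ (A i)) zero ≡ 0) → DiagonalForm A
  by-cases n A bounded tk _ (yes g≡0) =
    ⊥-elim (no-trivial-kernel (suc n) A (λ i → ℤP.∣i∣≡0⇒i≡0 (ΣN-zero (suc (suc n)) (λ i → ∣ ψ (A i) zero ∣) g≡0 i)) tk)
  by-cases zero A bounded tk g≤1 (no _) =
    two-by-two-case A bounded tk (λ i → ℕP.≤-trans (ΣN-term 2 (λ i → ∣ ψ (A i) zero ∣) i) (subst (_≤ 1) (ℕP.+-identityʳ _) g≤1))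
  by-cases (suc n) A bounded tk g+n≤1 (no g≢0) = ⊥-elim (g≢0 (ℕP.n≤0⇒n≡0 (ℕP.≤-trans (ℕP.m≤m+n _ n)
    (ℕP.≤-pred (subst (_≤ 1) (ℕP.+-suc _ n) g+n≤1)))))

bounded-theorem : ∀ n → BoundedTheorem n
bounded-theorem zero = bounded-base
bounded-theorem (suc n) A bounded tk with FinP.any? (λ b → colW A (inject₁ b) ≤? 2)
... | yes (b , light) = light-case (bounded-theorem n) A bounded tk b light
... | no none = heavy-case n A bounded tk (λ b light → none (b , light))

nonnegative : ∀ {x} → In012 x → x ≡ + ∣ x ∣
nonnegative is0 = refl
nonnegative is1 = refl
nonnegative is2 = refl

-- The hypotheses of the theorem: a row (a, 1) with entries in {0,1,2} and ∣ Σ a ∣ ≤ 2 has ψ-row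
-- (2 − W, a) with W = Σ a = Wt a ≤ 2, of weight ∣ 2 − W ∣ + W = 2.
initial-bound : ∀ n (A : Mat (suc n)) → (∀ i j → In012 (A i j)) → (∀ i → A i (fromℕ n) ≡ + 1) →
  (∀ i → ∣ Σ[ n ] (λ j → A i (inject₁ j)) ∣ ≤ 2) → BoundedBy ψ A
initial-bound n A entries last sums i = subst (_≤ 2) (sym weight) (total W (subst (_≤ 2) (cong ∣_∣ Σ≡W) (sums i)))
  where
  W = Wt (λ j → A i (inject₁ j))
  Σ≡W : Σ[ n ] (λ j → A i (inject₁ j)) ≡ + W
  Σ≡W = trans (Σ-cong n (λ j → nonnegative (entries i (inject₁ j)))) (sym (ΣN-as-Σ n (λ j → ∣ A i (inject₁ j) ∣)))
  weight : Wt (ψ (A i)) ≡ ∣ + 2 * 1ℤ + - (+ W) ∣ +ℕ W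
  weight = cong (_+ℕ W) (cong ∣_∣ (cong₂ (λ x y → + 2 * x + - y) (last i) Σ≡W))
  total : ∀ W → W ≤ 2 → ∣ + 2 * 1ℤ + - (+ W) ∣ +ℕ W ≤ 2
  total zero _ = ℕP.≤-refl
  total 1 _ = ℕP.≤-refl
  total 2 _ = ℕP.≤-refl
  total (suc (suc (suc W))) (s≤s (s≤s ()))

-- Cramer's rule gives a trivial kernel, the ψ-bounded theorem gives A ∼ D s, and the inverse of D s
-- up to the factor 2 transfers back to A along the unimodular equivalence.
proposition2p3 : (n : ℕ) → (A : Mat (suc n))
    → (∀ i j → In012 (A i j))
    → (∀ i → A i (fromℕ n) ≡ + 1)
    → (∀ i → ∣ Σ[ n ] (λ j → A i (inject₁ j)) ∣ ≤ 2)
    → det (suc n) A ≢ 0ℤ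
    → Σ ℕ (λ s → s ≤ suc n × A ∼ D s)
    × Σ (Mat (suc n)) (λ B → (∀ i j → (A · B) i j ≡ scale (+ 2) I i j)
    × (∀ i j → (B · A) i j ≡ scale (+ 2) I i j))
proposition2p3 n A entries last sums det≢0 = diagonal-form , twice-≅ (≅-sym (∼-≅ A∼D)) (D-twice-invertible s)
  where
  diagonal-form : DiagonalForm A
  diagonal-form = bounded-theorem n A (initial-bound n A entries last sums) (det≢0⇒trivial-kernel (suc n) A det≢0)
  s = proj₁ diagonal-form
  A∼D = proj₂ (proj₂ diagonal-form)
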